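{- Let $(\mathcal{M}^{\dagger},\textsf{AX}^{\dagger})$ be any one of the pairs $(\mathcal{M},\textsf{AX})$, $(\mathcal{M}_{\mathrm{det}},\textsf{AX}_{\mathrm{det}})$, $(\mathcal{M}^{\downarrow},\textsf{AX}^{\downarrow})$, $(\mathcal{M}^{\downarrow}_{\mathrm{det}},\textsf{AX}^{\downarrow}_{\mathrm{det}})$, and let $\mathcal{M}^{\dagger,\mathrm{fin}}$ be the class of those $(\mathsf{T},\mathbf{x})\in\mathcal{M}^{\dagger}$ such that $\mathsf{T}$ uses only boundedly many tape variables, for any input and intervention (finite state machine restrictions). Then for every $\varphi\in\mathcal{L}$, $\varphi$ is provable in $\textsf{AX}^{\dagger}$ if and only if $\mathfrak{M}\models\varphi$ for every $\mathfrak{M}\in\mathcal{M}^{\dagger,\mathrm{fin}}$.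
   Context: Language. Fix propositional atoms $X_1,X_2,\dots$. $\mathcal{L}_{\mathrm{prop}}$ is the set of propositional formulas over them. $\mathcal{L}_{\mathrm{int}}\subset\mathcal{L}_{\mathrm{prop}}$ consists of $\top$ and all formulas $l_{i_1}\land\dots\land l_{i_n}$ with $i_1<\dots<i_n$, each $l_{i_j}$ being $X_{i_j}$ or $\lnot X_{i_j}$. $\mathcal{L}_{\mathrm{cond}}$ is the set of $[\alpha]\beta$ with $\alpha\in\mathcal{L}_{\mathrm{int}}$, $\beta\in\mathcal{L}_{\mathrm{prop}}$; $\mathcal{L}$ is the set of propositional formulas over atoms $\{X_i\}\cup\mathcal{L}_{\mathrm{cond}}$; $\alpha\to\beta$ abbreviates $\lnot\alpha\lor\beta$; $\langle\alpha\rangle\beta$ abbreviates $\lnot[\alpha]\lnot\beta$. Semantics. A causal simulation model is a pair $(\mathsf{T},\mathbf{x})$ where $\mathsf{T}$ is a (possibly non-deterministic) Turing machine whose tape consists of binary variables $X_1,X_2,\dots$, and $\mathbf{x}$ assigns a value in $\{0,1\}$ to each, only finitely many nonzero. For $\alpha\in\mathcal{L}_{\mathrm{int}}$, $\mathcal{I}_\alpha(\mathsf{T})$ first sets each variable occurring in $\alpha$ to the value dictated by its literal ($1$ for $X_i$, $0$ for $\lnot X_i$) and then runs $\mathsf{T}$ ignoring all writes to those variables. $(\mathsf{T},\mathbf{x})\models X_i$ iff $x_i=1$; $(\mathsf{T},\mathbf{x})\models[\alpha]\beta$ iff every halting execution of $\mathcal{I}_\alpha(\mathsf{T})$ on $\mathbf{x}$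 yields a tape satisfying $\beta$; Boolean connectives as usual. Model classes. $\mathcal{M}$: all causal simulation models; $\mathcal{M}_{\mathrm{det}}$: those with deterministic $\mathsf{T}$; $\mathcal{M}^{\downarrow}$: those with $\mathsf{T}$ halting on all input tapes under all interventions; $\mathcal{M}^{\downarrow}_{\mathrm{det}}=\mathcal{M}_{\mathrm{det}}\cap\mathcal{M}^{\downarrow}$. Axiom systems ($\alpha\in\mathcal{L}_{\mathrm{int}}$, $\beta,\beta',\gamma\in\mathcal{L}_{\mathrm{prop}}$): PC: propositional calculus over the atoms of $\mathcal{L}$; RW: from $\beta\to\beta'$ infer $[\alpha]\beta\to[\alpha]\beta'$; R: $[\alpha]\alpha$; K: $[\alpha](\beta\to\gamma)\to([\alpha]\beta\to[\alpha]\gamma)$; F: $\langle\alpha\rangle\beta\to[\alpha]\beta$; D: $[\alpha]\beta\to\langle\alpha\rangle\beta$. $\textsf{AX}$ contains R and K and is closed under PC and RW; $\textsf{AX}_{\mathrm{det}}=\textsf{AX}+\textsf{F}$; $\textsf{AX}^{\downarrow}=\textsf{AX}+\textsf{D}$; $\textsf{AX}^{\downarrow}_{\mathrm{det}}=\textsf{AX}+\textsf{F}+\textsf{D}$. -}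

module Defs where

open import Data.Bool using (Bool; true; false; if_then_else_; not; _∧_; _∨_)
open import Data.Nat using (ℕ; zero; suc; _<_; _≤_; _≟_)
open import Data.Product using (_×_; _,_; proj₁; proj₂; Σ; ∃)
open import Data.Maybe using (Maybe; just; nothing)
open import Data.List using (List; []; _∷_)
open import Data.List.NonEmpty using (List⁺; toList; tail)
open import Data.List.Membership.Propositional using (_∈_)
open import Data.List.Relation.Unary.Linked using (Linked)
open import Data.Fin using (Fin)
open import Data.Unit using (⊤)
open import Relation.Nullary using (¬_; yes; no)
open import Relation.Binary.PropositionalEquality using (_≡_)
open import Relation.Binary.Construct.Closure.ReflexiveTransitive using (Star)
open import Induction.WellFounded using (Acc)

-- Conventions: the atom X_{i+1} of the paper is written X i (i : ℕ),
-- and it is the tape cell with index i.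

infixr 6 _∧̇_
infixr 5 _∨̇_
infixr 4 _⇒̇_

data Fm (A : Set) : Set where
  atom : A → Fm A
  ⊤̇    : Fm A
  ¬̇_   : Fm A → Fm A
  _∧̇_  : Fm A → Fm A → Fm A
  _∨̇_  : Fm A → Fm A → Fm A

_⇒̇_ : ∀ {A} → Fm A → Fm A → Fm A
φ ⇒̇ ψ = (¬̇ φ) ∨̇ ψ

mapFm : ∀ {A B : Set} → (A → B) → Fm A → Fm B
mapFm f (atom a) = atom (f a)
mapFm f ⊤̇ = ⊤̇
mapFm f (¬̇ φ) = ¬̇ mapFm f φ
mapFm f (φ ∧̇ ψ) = mapFm f φ ∧̇ mapFm f ψ
mapFm f (φ ∨̇ ψ) = mapFm f φ ∨̇ mapFm f ψ

evalB : ∀ {A : Set} → (A → Bool) → Fm A → Bool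
evalB v (atom a) = v a
evalB v ⊤̇ = true
evalB v (¬̇ φ) = not (evalB v φ)
evalB v (φ ∧̇ ψ) = evalB v φ ∧ evalB v ψ
evalB v (φ ∨̇ ψ) = evalB v φ ∨ evalB v ψ

PForm : Set
PForm = Fm ℕ

-- L_int : ⊤ or a conjunction of literals with strictly increasing indices.
-- A literal is (i , true) for X i and (i , false) for ¬ X i.

Literal : Set
Literal = ℕ × Bool

record Intv : Set where
  constructor mkIntv
  field
    lits   : List Literal
    sorted : Linked (λ l l′ → proj₁ l < proj₁ l′) lits
open Intv public

litForm : Literal → PForm
litForm (i , true)  = atom i
litForm (i , false) = ¬̇ atom i

conjLits : List Literal → PForm
conjLits [] = ⊤̇
conjLits (l ∷ []) = litForm l
conjLits (l ∷ l′ ∷ ls) = litForm l ∧̇ conjLits (l′ ∷ ls)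

intvForm : Intv → PForm
intvForm α = conjLits (lits α)

data Atom : Set where
  X   : ℕ → Atom
  box : Intv → PForm → Atom

Form : Set
Form = Fm Atom

ι : PForm → Form
ι = mapFm X

[_]_ : Intv → PForm → Form
[ α ] β = atom (box α β)

⟨_⟩_ : Intv → PForm → Form
⟨ α ⟩ β = ¬̇ atom (box α (¬̇ β))

Tautology : Form → Set
Tautology φ = ∀ (v : Atom → Bool) → evalB v φ ≡ true

data AX[_,_]⊢_ (f d : Bool) : Form → Set where
  pc-taut : ∀ {φ} → Tautology φ → AX[ f , d ]⊢ φ
  pc-mp   : ∀ {φ ψ} → AX[ f , d ]⊢ (φ ⇒̇ ψ) → AX[ f , d ]⊢ φ → AX[ f , d ]⊢ ψ
  RW      : ∀ {α β β′} → AX[ f , d ]⊢ ι (β ⇒̇ β′)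
            → AX[ f , d ]⊢ ([ α ] β ⇒̇ [ α ] β′)
  R       : ∀ {α} → AX[ f , d ]⊢ [ α ] intvForm α
  K       : ∀ {α β γ} → AX[ f , d ]⊢ ([ α ] (β ⇒̇ γ) ⇒̇ ([ α ] β ⇒̇ [ α ] γ))
  F       : ∀ {α β} → f ≡ true → AX[ f , d ]⊢ (⟨ α ⟩ β ⇒̇ [ α ] β)
  D       : ∀ {α β} → d ≡ true → AX[ f , d ]⊢ ([ α ] β ⇒̇ ⟨ α ⟩ β)

-- The head starts at
-- cell 0 (X_1); moving left from cell 0 stays at cell 0.

Tape : Set
Tape = ℕ → Bool

data Move : Set where
  L S R : Move

move : Move → ℕ → ℕ
move L zero    = zero
move L (suc h) = h
move S h       = h
move R h       = suc h

record TM : Set where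
  field
    nQ    : ℕ
    start : Fin nQ
    halt  : Fin nQ → Bool
    δ     : Fin nQ → Bool → List⁺ (Fin nQ × Bool × Move)
open TM public

FinSupp : Tape → Set
FinSupp x = ∃ λ N → ∀ i → N ≤ i → x i ≡ false

forced : List Literal → ℕ → Maybe Bool
forced [] i = nothing
forced ((j , b) ∷ ls) i with j ≟ i
... | yes _ = just b
... | no  _ = forced ls i

setIntv : Intv → Tape → Tape
setIntv α x i with forced (lits α) i
... | just b  = b
... | nothing = x i

writeIntv : Intv → ℕ → Bool → Tape → Tape
writeIntv α h b t i with forced (lits α) i | h ≟ i
... | just c  | _     = t i
... | nothing | yes _ = b
... | nothing | no  _ = t i

record Config (T : TM) : Set where
  constructor cfg
  field
    state : Fin (nQ T)
    pos   : ℕ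
    tape  : Tape
open Config public

data Step (T : TM) (α : Intv) : Config T → Config T → Set where
  step : ∀ {q h t q′ b m}
       → halt T q ≡ false
       → (q′ , b , m) ∈ toList (δ T q (t h))
       → Step T α (cfg q h t) (cfg q′ (move m h) (writeIntv α h b t))

initCfg : (T : TM) → Intv → Tape → Config T
initCfg T α x = cfg (start T) zero (setIntv α x)

Reach : (T : TM) → Intv → Tape → Config T → Set
Reach T α x c = Star (Step T α) (initCfg T α x) c

HaltingRun : (T : TM) → Intv → Tape → Config T → Set
HaltingRun T α x c = Reach T α x c × halt T (state c) ≡ true

record Model : Set where
  constructor ⟨_,_,_⟩
  field
    T      : TM
    x      : Tape
    finite : FinSupp x
open Model public

-- Satisfaction; connectives read classically (∨ as ¬(¬ ∧ ¬)); all atoms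
-- give ¬¬-stable propositions.
Sat : Model → Form → Set
Sat M (atom (X i))      = x M i ≡ true
Sat M (atom (box α β))  =
  ∀ c → HaltingRun (T M) α (x M) c → evalB (tape c) β ≡ true
Sat M ⊤̇                 = ⊤
Sat M (¬̇ φ)             = ¬ Sat M φ
Sat M (φ ∧̇ ψ)           = Sat M φ × Sat M ψ
Sat M (φ ∨̇ ψ)           = ¬ (¬ Sat M φ × ¬ Sat M ψ)

Deterministic : TM → Set
Deterministic T = ∀ q b → tail (δ T q b) ≡ []

-- every execution of I_α(T) from c halts (all computation paths finite)
AllHalt : (T : TM) → Intv → Config T → Set
AllHalt T α c = Acc (λ c′ c₀ → Step T α c₀ c′) c

AlwaysHalts : TM → Set
AlwaysHalts T = ∀ α x → FinSupp x → AllHalt T α (initCfg T α x)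

BoundedTape : TM → Set
BoundedTape T = ∃ λ N → ∀ α x → FinSupp x → ∀ c → Reach T α x c → pos c < N

-- M^{†,fin} with † determined by (det , hlt):
--   (false,false) = M, (true,false) = M_det, (false,true) = M↓, (true,true) = M↓_det
InClassFin : (det hlt : Bool) → Model → Set
InClassFin det hlt M =
  (det ≡ true → Deterministic (T M)) ×
  (hlt ≡ true → AlwaysHalts (T M)) ×
  BoundedTape (T M)

-- Soundness is checked rule by rule; for RW, a propositional formula valid on the class
-- is a tautology, as the machine that halts at once shows on finitely supported tapes.
--
-- Completeness is by a finite canonical model. Let n bound every cell mentioned in φ and
-- let v be a Boolean valuation of the atoms of φ that satisfies every derivable box rule
-- [α]β₁ ∧ … ∧ [α]βₖ → [α]γ₁ ∨ … ∨ [α]γₘ over the boxes of φ. For an intervention α of φ,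
-- take for the βs the boxes v makes true and for the γs boxes v makes false that one
-- halting run has to refute (all of them under F, a single one otherwise, and also none
-- under D, so that some run exists). v falsifies that rule, so it is not derivable, and
-- by RW and K (plus D, resp. F, when there are no, resp. several, γs) some tape satisfies
-- α and all βs and refutes all γs. The countermodel machine probes cells 0 … n - 1 to
-- learn the intervention there, then writes one of these witness tapes (restricted to n
-- cells) and halts. It uses n + 1 cells, always halts under D, is deterministic under F,
-- and satisfies exactly the atoms of φ that v makes true. So a valid φ is true under
-- every such v: it follows propositionally from the derivable box rules.

module Submission where

open import Defs
open import Data.Bool using (Bool; true; false; not; _∧_; _∨_; if_then_else_)
open import Data.Bool.Properties using () renaming (_≟_ to _≟ᵇ_)
open import Data.Empty using (⊥-elim)
open import Data.Fin using (Fin; zero)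
open import Data.List using (List; []; _∷_; _++_; map; length; lookup; concatMap; upTo; filter)
open import Data.List.NonEmpty as List⁺ using (List⁺; toList) renaming (_∷_ to _∷⁺_)
open import Data.List.Membership.Propositional using (_∈_; find; lose)
open import Data.List.Membership.Propositional.Properties
  using (∈-++⁺ˡ; ∈-++⁺ʳ; ∈-++⁻; ∈-map⁺; ∈-map⁻; ∈-filter⁺; ∈-filter⁻;
         ∈-concatMap⁺; ∈-concatMap⁻; ∈-upTo⁺)
open import Data.List.Extrema.Nat using (max; xs≤max)
open import Data.List.Relation.Binary.Pointwise using (Pointwise; []; _∷_; Pointwise-length)
  renaming (decidable to pointwise?)
open import Data.List.Relation.Unary.All as All using (All; []; _∷_)
import Data.List.Relation.Unary.All.Properties as All
open import Data.List.Relation.Unary.Any using (Any; here; there; index; any?)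
open import Data.List.Relation.Unary.Any.Properties using (lookup-index)
open import Data.List.Relation.Unary.Linked using (Linked; []; [-]; _∷_)
open import Data.Maybe using (Maybe; just; nothing)
open import Data.Nat using (ℕ; zero; suc; _<_; _≤_; _+_; _∸_; pred; z≤n; s≤s; _<?_)
  renaming (_≟_ to _≟ℕ_)
open import Data.Nat.Properties
open import Data.Product using (_×_; _,_; proj₁; proj₂; ∃)
open import Data.Sum using (_⊎_; inj₁; inj₂)
open import Data.Unit using (⊤; tt)
open import Function.Bundles using (_⇔_; mk⇔)
open Function.Bundles.Equivalence using (to; from)
open import Relation.Binary.Construct.Closure.ReflexiveTransitive using (Star; ε; _◅_; _◅◅_)
open import Relation.Binary.PropositionalEquality
  using (_≡_; _≢_; _≗_; refl; sym; trans; cong; cong₂; subst)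
open import Relation.Binary.Definitions using (tri<; tri≈; tri>)
open import Relation.Nullary using (¬_; Dec; yes; no; does)
open import Relation.Nullary.Decidable using (map′; ¬?; _×-dec_; _⊎-dec_; _→-dec_)
open import Induction.WellFounded using (acc)
import Data.List.Properties as List
import Data.Maybe.Properties as Maybe
import Data.Product.Properties as Product
import Data.Sum.Properties as Sum
import Data.Unit.Properties as Unit

false≢true : false ≢ true
false≢true ()

atoms : ∀ {A : Set} → Fm A → List A
atoms (atom a) = a ∷ []
atoms ⊤̇ = []
atoms (¬̇ φ) = atoms φ
atoms (φ ∧̇ ψ) = atoms φ ++ atoms ψ
atoms (φ ∨̇ ψ) = atoms φ ++ atoms ψ

evalB-cong : ∀ {A : Set} (v w : A → Bool) (φ : Fm A) →
  (∀ a → a ∈ atoms φ → v a ≡ w a) → evalB v φ ≡ evalB w φ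
evalB-cong v w (atom a) h = h a (here refl)
evalB-cong v w ⊤̇ h = refl
evalB-cong v w (¬̇ φ) h = cong not (evalB-cong v w φ h)
evalB-cong v w (φ ∧̇ ψ) h = cong₂ _∧_ (evalB-cong v w φ (λ a m → h a (∈-++⁺ˡ m)))
  (evalB-cong v w ψ (λ a m → h a (∈-++⁺ʳ (atoms φ) m)))
evalB-cong v w (φ ∨̇ ψ) h = cong₂ _∨_ (evalB-cong v w φ (λ a m → h a (∈-++⁺ˡ m)))
  (evalB-cong v w ψ (λ a m → h a (∈-++⁺ʳ (atoms φ) m)))

evalB-mapFm : ∀ {A B : Set} (f : A → B) (v : B → Bool) (φ : Fm A) →
  evalB v (mapFm f φ) ≡ evalB (λ a → v (f a)) φ
evalB-mapFm f v (atom a) = refl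
evalB-mapFm f v ⊤̇ = refl
evalB-mapFm f v (¬̇ φ) = cong not (evalB-mapFm f v φ)
evalB-mapFm f v (φ ∧̇ ψ) = cong₂ _∧_ (evalB-mapFm f v φ) (evalB-mapFm f v ψ)
evalB-mapFm f v (φ ∨̇ ψ) = cong₂ _∨_ (evalB-mapFm f v φ) (evalB-mapFm f v ψ)

module _ {A : Set} (v : A → Bool) where

  Holds : Fm A → Set
  Holds φ = evalB v φ ≡ true

  holds? : ∀ φ → Dec (Holds φ)
  holds? φ = evalB v φ ≟ᵇ true

  ⇒I : ∀ φ ψ → (Holds φ → Holds ψ) → Holds (φ ⇒̇ ψ)
  ⇒I φ ψ h with evalB v φ
  ... | true = h refl
  ... | false = refl

  ⇒E : ∀ φ ψ → Holds (φ ⇒̇ ψ) → Holds φ → Holds ψ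
  ⇒E φ ψ h e rewrite e = h

  ¬I : ∀ φ → ¬ Holds φ → Holds (¬̇ φ)
  ¬I φ h with evalB v φ
  ... | true = ⊥-elim (h refl)
  ... | false = refl

  ¬E : ∀ φ → Holds (¬̇ φ) → ¬ Holds φ
  ¬E φ h e with evalB v φ
  ¬E φ () refl | true

  ∧I : ∀ φ ψ → Holds φ → Holds ψ → Holds (φ ∧̇ ψ)
  ∧I φ ψ a b rewrite a | b = refl

  ∧E₁ : ∀ φ ψ → Holds (φ ∧̇ ψ) → Holds φ
  ∧E₁ φ ψ h with evalB v φ
  ... | true = refl
  ... | false = h

  ∧E₂ : ∀ φ ψ → Holds (φ ∧̇ ψ) → Holds ψ
  ∧E₂ φ ψ h with evalB v φ
  ... | true = h

  ∨I₁ : ∀ φ ψ → Holds φ → Holds (φ ∨̇ ψ)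
  ∨I₁ φ ψ a rewrite a = refl

  ∨I₂ : ∀ φ ψ → Holds ψ → Holds (φ ∨̇ ψ)
  ∨I₂ φ ψ b with evalB v φ
  ... | true = refl
  ... | false = b

  ∨E : ∀ φ ψ → Holds (φ ∨̇ ψ) → Holds φ ⊎ Holds ψ
  ∨E φ ψ h with evalB v φ
  ... | true = inj₁ refl
  ... | false = inj₂ h

⋀ : ∀ {A : Set} → List (Fm A) → Fm A
⋀ [] = ⊤̇
⋀ (φ ∷ φs) = φ ∧̇ ⋀ φs

⋁ : ∀ {A : Set} → List (Fm A) → Fm A
⋁ [] = ¬̇ ⊤̇
⋁ (φ ∷ φs) = φ ∨̇ ⋁ φs

Holds-⋀⁻ : ∀ {A : Set} (v : A → Bool) φs → Holds v (⋀ φs) → All (Holds v) φs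
Holds-⋀⁻ v [] h = []
Holds-⋀⁻ v (φ ∷ φs) h = ∧E₁ v φ (⋀ φs) h ∷ Holds-⋀⁻ v φs (∧E₂ v φ (⋀ φs) h)

Holds-⋀⁺ : ∀ {A : Set} (v : A → Bool) φs → All (Holds v) φs → Holds v (⋀ φs)
Holds-⋀⁺ v [] h = refl
Holds-⋀⁺ v (φ ∷ φs) (p ∷ ps) = ∧I v φ (⋀ φs) p (Holds-⋀⁺ v φs ps)

Holds-⋁⁻ : ∀ {A : Set} (v : A → Bool) φs → Holds v (⋁ φs) → Any (Holds v) φs
Holds-⋁⁻ v [] ()
Holds-⋁⁻ v (φ ∷ φs) h with ∨E v φ (⋁ φs) h
... | inj₁ p = here p
... | inj₂ p = there (Holds-⋁⁻ v φs p)

Sorted : List Literal → Set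
Sorted = Linked (λ l l′ → proj₁ l < proj₁ l′)

Sorted-irrelevant : ∀ {ls} (p q : Sorted ls) → p ≡ q
Sorted-irrelevant [] [] = refl
Sorted-irrelevant [-] [-] = refl
Sorted-irrelevant (a ∷ p) (b ∷ q) = cong₂ _∷_ (<-irrelevant a b) (Sorted-irrelevant p q)

Intv-≡ : ∀ {α α′ : Intv} → lits α ≡ lits α′ → α ≡ α′
Intv-≡ {mkIntv ls p} {mkIntv .ls q} refl = cong (mkIntv ls) (Sorted-irrelevant p q)

_≟ᴵ_ : (α α′ : Intv) → Dec (α ≡ α′)
α ≟ᴵ α′ with List.≡-dec (Product.≡-dec _≟ℕ_ _≟ᵇ_) (lits α) (lits α′)
... | yes e = yes (Intv-≡ e)
... | no ne = no λ e → ne (cong lits e)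

Fm-≡-dec : ∀ {A : Set} → ((a b : A) → Dec (a ≡ b)) → (φ ψ : Fm A) → Dec (φ ≡ ψ)
Fm-≡-dec _≟_ (atom a) (atom b) with a ≟ b
... | yes refl = yes refl
... | no ne = no λ { refl → ne refl }
Fm-≡-dec _≟_ ⊤̇ ⊤̇ = yes refl
Fm-≡-dec _≟_ (¬̇ φ) (¬̇ ψ) with Fm-≡-dec _≟_ φ ψ
... | yes refl = yes refl
... | no ne = no λ { refl → ne refl }
Fm-≡-dec _≟_ (φ ∧̇ φ′) (ψ ∧̇ ψ′) with Fm-≡-dec _≟_ φ ψ | Fm-≡-dec _≟_ φ′ ψ′
... | yes refl | yes refl = yes refl
... | no ne | _ = no λ { refl → ne refl }
... | yes _ | no ne = no λ { refl → ne refl }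
Fm-≡-dec _≟_ (φ ∨̇ φ′) (ψ ∨̇ ψ′) with Fm-≡-dec _≟_ φ ψ | Fm-≡-dec _≟_ φ′ ψ′
... | yes refl | yes refl = yes refl
... | no ne | _ = no λ { refl → ne refl }
... | yes _ | no ne = no λ { refl → ne refl }
Fm-≡-dec _≟_ (atom _) ⊤̇ = no λ ()
Fm-≡-dec _≟_ (atom _) (¬̇ _) = no λ ()
Fm-≡-dec _≟_ (atom _) (_ ∧̇ _) = no λ ()
Fm-≡-dec _≟_ (atom _) (_ ∨̇ _) = no λ ()
Fm-≡-dec _≟_ ⊤̇ (atom _) = no λ ()
Fm-≡-dec _≟_ ⊤̇ (¬̇ _) = no λ ()
Fm-≡-dec _≟_ ⊤̇ (_ ∧̇ _) = no λ ()
Fm-≡-dec _≟_ ⊤̇ (_ ∨̇ _) = no λ ()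
Fm-≡-dec _≟_ (¬̇ _) (atom _) = no λ ()
Fm-≡-dec _≟_ (¬̇ _) ⊤̇ = no λ ()
Fm-≡-dec _≟_ (¬̇ _) (_ ∧̇ _) = no λ ()
Fm-≡-dec _≟_ (¬̇ _) (_ ∨̇ _) = no λ ()
Fm-≡-dec _≟_ (_ ∧̇ _) (atom _) = no λ ()
Fm-≡-dec _≟_ (_ ∧̇ _) ⊤̇ = no λ ()
Fm-≡-dec _≟_ (_ ∧̇ _) (¬̇ _) = no λ ()
Fm-≡-dec _≟_ (_ ∧̇ _) (_ ∨̇ _) = no λ ()
Fm-≡-dec _≟_ (_ ∨̇ _) (atom _) = no λ ()
Fm-≡-dec _≟_ (_ ∨̇ _) ⊤̇ = no λ ()
Fm-≡-dec _≟_ (_ ∨̇ _) (¬̇ _) = no λ ()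
Fm-≡-dec _≟_ (_ ∨̇ _) (_ ∧̇ _) = no λ ()

_≟ᴬ_ : (a b : Atom) → Dec (a ≡ b)
X i ≟ᴬ X j with i ≟ℕ j
... | yes refl = yes refl
... | no ne = no λ { refl → ne refl }
X _ ≟ᴬ box _ _ = no λ ()
box _ _ ≟ᴬ X _ = no λ ()
box α β ≟ᴬ box α′ β′ with α ≟ᴵ α′ | Fm-≡-dec _≟ℕ_ β β′
... | yes refl | yes refl = yes refl
... | no ne | _ = no λ { refl → ne refl }
... | yes _ | no ne = no λ { refl → ne refl }

does⇔ : ∀ {P : Set} (d : Dec P) → P ⇔ (does d ≡ true)
does⇔ (yes p) = mk⇔ (λ _ → refl) (λ _ → p)
does⇔ (no ¬p) = mk⇔ (λ p → ⊥-elim (¬p p)) λ ()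

Sat-stable : ∀ M φ → ¬ ¬ Sat M φ → Sat M φ
Sat-stable M (atom (X i)) nn with x M i
... | true = refl
... | false = ⊥-elim (nn false≢true)
Sat-stable M (atom (box α β)) nn c h with evalB (tape c) β in e
... | true = refl
... | false = ⊥-elim (nn λ s → false≢true (trans (sym e) (s c h)))
Sat-stable M ⊤̇ nn = tt
Sat-stable M (¬̇ φ) nn p = nn λ np → np p
Sat-stable M (φ ∧̇ ψ) nn = Sat-stable M φ (λ n → nn λ p → n (proj₁ p)) ,
                          Sat-stable M ψ (λ n → nn λ p → n (proj₂ p))
Sat-stable M (φ ∨̇ ψ) nn p = nn λ q → q p

Sat-⇒⁺ : ∀ M φ ψ → (Sat M φ → Sat M ψ) → Sat M (φ ⇒̇ ψ)
Sat-⇒⁺ M φ ψ f (nnφ , ¬ψ) = nnφ λ a → ¬ψ (f a)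

Sat-⇒⁻ : ∀ M φ ψ → Sat M (φ ⇒̇ ψ) → Sat M φ → Sat M ψ
Sat-⇒⁻ M φ ψ h a = Sat-stable M ψ λ ¬b → h ((λ ¬a → ¬a a) , ¬b)

Agree : Model → (Atom → Bool) → Atom → Set
Agree M v a = Sat M (atom a) ⇔ (v a ≡ true)

Sat⇔Holds : ∀ M v φ → (∀ a → a ∈ atoms φ → Agree M v a) → Sat M φ ⇔ Holds v φ
Sat⇔Holds M v (atom a) h = h a (here refl)
Sat⇔Holds M v ⊤̇ h = mk⇔ (λ _ → refl) (λ _ → tt)
Sat⇔Holds M v (¬̇ φ) h =
  mk⇔ (λ ¬s → ¬I v φ λ p → ¬s (from e p)) (λ p s → ¬E v φ p (to e s))
  where e = Sat⇔Holds M v φ h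
Sat⇔Holds M v (φ ∧̇ ψ) h =
  mk⇔ (λ (a , b) → ∧I v φ ψ (to e₁ a) (to e₂ b))
      (λ p → from e₁ (∧E₁ v φ ψ p) , from e₂ (∧E₂ v φ ψ p))
  where e₁ = Sat⇔Holds M v φ (λ a m → h a (∈-++⁺ˡ m))
        e₂ = Sat⇔Holds M v ψ (λ a m → h a (∈-++⁺ʳ (atoms φ) m))
Sat⇔Holds M v (φ ∨̇ ψ) h = mk⇔ to′ from′
  where
  e₁ = Sat⇔Holds M v φ (λ a m → h a (∈-++⁺ˡ m))
  e₂ = Sat⇔Holds M v ψ (λ a m → h a (∈-++⁺ʳ (atoms φ) m))
  to′ : Sat M (φ ∨̇ ψ) → Holds v (φ ∨̇ ψ)
  to′ s with holds? v φ | holds? v ψ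
  ... | yes p | _ = ∨I₁ v φ ψ p
  ... | no _ | yes q = ∨I₂ v φ ψ q
  ... | no ¬p | no ¬q = ⊥-elim (s ((λ a → ¬p (to e₁ a)) , (λ b → ¬q (to e₂ b))))
  from′ : Holds v (φ ∨̇ ψ) → Sat M (φ ∨̇ ψ)
  from′ p (¬a , ¬b) with ∨E v φ ψ p
  ... | inj₁ q = ¬a (from e₁ q)
  ... | inj₂ q = ¬b (from e₂ q)

-- Sat is ¬¬-stable, so under a double negation the finitely many atoms of φ may be
-- decided, which yields a Boolean valuation agreeing with M on them.
module _ (M : Model) where
  open import Data.List.Membership.DecPropositional _≟ᴬ_ using (_∈?_)

  DecidedAtoms : List Atom → Set
  DecidedAtoms = All (λ a → Dec (Sat M (atom a)))

  ¬¬decidedAtoms : ∀ as → ¬ ¬ DecidedAtoms as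
  ¬¬decidedAtoms [] k = k []
  ¬¬decidedAtoms (a ∷ as) k =
    k′ λ d → ¬¬decidedAtoms as λ ds → k (d ∷ ds)
    where k′ : ¬ ¬ Dec (Sat M (atom a))
          k′ k = k (no λ p → k (yes p))

  decidedValuation : ∀ as → DecidedAtoms as → Atom → Bool
  decidedValuation as ds a with a ∈? as
  ... | yes m = does (All.lookup ds m)
  ... | no _ = false

  decidedValuation-agrees : ∀ as ds a → a ∈ as → Agree M (decidedValuation as ds) a
  decidedValuation-agrees as ds a m with a ∈? as
  ... | yes m′ = does⇔ (All.lookup ds m′)
  ... | no ∉ = ⊥-elim (∉ m)

  Sat-tautology : ∀ φ → Tautology φ → Sat M φ
  Sat-tautology φ t = Sat-stable M φ λ ¬s → ¬¬decidedAtoms (atoms φ) λ ds →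
    ¬s (from (Sat⇔Holds M _ φ (decidedValuation-agrees (atoms φ) ds)) (t _))

Sorted-head : ∀ {l ls} → Sorted (l ∷ ls) → All (λ l′ → proj₁ l < proj₁ l′) ls
Sorted-head [-] = []
Sorted-head (r ∷ rs) = r ∷ All.map (<-trans r) (Sorted-head rs)

Sorted-tail : ∀ {l ls} → Sorted (l ∷ ls) → Sorted ls
Sorted-tail [-] = []
Sorted-tail (_ ∷ rs) = rs

forced-hit : ∀ i b ls → forced ((i , b) ∷ ls) i ≡ just b
forced-hit i b ls with i ≟ℕ i
... | yes _ = refl
... | no ne = ⊥-elim (ne refl)

forced-skip : ∀ {j k} c ls → j ≢ k → forced ((j , c) ∷ ls) k ≡ forced ls k
forced-skip {j} {k} c ls ne with j ≟ℕ k
... | yes e = ⊥-elim (ne e)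
... | no _ = refl

forced-nothing : ∀ {i} ls → All (λ l → proj₁ l ≢ i) ls → forced ls i ≡ nothing
forced-nothing [] [] = refl
forced-nothing ((j , c) ∷ ls) (ne ∷ nes) = trans (forced-skip c ls ne) (forced-nothing ls nes)

forced-∈ : ∀ {ls i b} → Sorted ls → (i , b) ∈ ls → forced ls i ≡ just b
forced-∈ {(i , b) ∷ ls} s (here refl) = forced-hit i b ls
forced-∈ {(j , c) ∷ ls} s (there m) =
  trans (forced-skip c ls (<⇒≢ (All.lookup (Sorted-head s) m))) (forced-∈ (Sorted-tail s) m)

forced⇒∈ : ∀ ls {i b} → forced ls i ≡ just b → (i , b) ∈ ls
forced⇒∈ ((j , c) ∷ ls) {i} e with j ≟ℕ i
forced⇒∈ ((j , c) ∷ ls) refl | yes refl = here refl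
... | no _ = there (forced⇒∈ ls e)

forced-below : ∀ {i l ls} → Sorted (l ∷ ls) → i < proj₁ l → forced (l ∷ ls) i ≡ nothing
forced-below s i<j =
  forced-nothing _ (>⇒≢ i<j ∷ All.map (λ j<k → >⇒≢ (<-trans i<j j<k)) (Sorted-head s))

forced-injective : ∀ {ls ls′} → Sorted ls → Sorted ls′ → forced ls ≗ forced ls′ → ls ≡ ls′
forced-injective {[]} {[]} _ _ _ = refl
forced-injective {[]} {(j , c) ∷ ls′} _ _ e with () ← trans (e j) (forced-hit j c ls′)
forced-injective {(i , b) ∷ ls} {[]} _ _ e with () ← trans (sym (e i)) (forced-hit i b ls)
forced-injective {(i , b) ∷ ls} {(j , c) ∷ ls′} s s′ e with <-cmp i j
... | tri< i<j _ _ with () ← trans (sym (forced-hit i b ls)) (trans (e i) (forced-below s′ i<j))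
... | tri> _ _ j<i with () ← trans (sym (forced-below s j<i)) (trans (e j) (forced-hit j c ls′))
... | tri≈ _ refl _ with refl ← trans (sym (forced-hit i b ls)) (trans (e i) (forced-hit i c ls′)) =
  cong ((i , b) ∷_) (forced-injective (Sorted-tail s) (Sorted-tail s′) tails)
  where
  tails : forced ls ≗ forced ls′
  tails k with i ≟ℕ k
  ... | yes refl = trans (forced-nothing ls (All.map >⇒≢ (Sorted-head s)))
                         (sym (forced-nothing ls′ (All.map >⇒≢ (Sorted-head s′))))
  ... | no ne = trans (sym (forced-skip b ls ne)) (trans (e k) (forced-skip b ls′ ne))

-- Listed from cell k - 1 down to cell 0, the order in which the machine reads it.
signature : ℕ → Intv → List (Maybe Bool)
signature zero α = []
signature (suc k) α = forced (lits α) k ∷ signature k α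

length-signature : ∀ k α → length (signature k α) ≡ k
length-signature zero α = refl
length-signature (suc k) α = cong suc (length-signature k α)

signature-forced : ∀ k α α′ → signature k α ≡ signature k α′ →
  ∀ i → i < k → forced (lits α) i ≡ forced (lits α′) i
signature-forced (suc k) α α′ e i i<1+k with m≤n⇒m<n∨m≡n (≤-pred i<1+k)
... | inj₁ i<k = signature-forced k α α′ (List.∷-injectiveʳ e) i i<k
... | inj₂ refl = List.∷-injectiveˡ e

IndicesBelow : ℕ → Intv → Set
IndicesBelow n α = All (λ l → proj₁ l < n) (lits α)

signature-injective : ∀ n α α′ → IndicesBelow n α → IndicesBelow n α′ →
  signature n α ≡ signature n α′ → α ≡ α′
signature-injective n α α′ b b′ e = Intv-≡ (forced-injective (sorted α) (sorted α′) agree)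
  where
  agree : forced (lits α) ≗ forced (lits α′)
  agree i with i <? n
  ... | yes i<n = signature-forced n α α′ e i i<n
  ... | no i≮n = trans (forced-nothing (lits α) (All.map beyond b))
                       (sym (forced-nothing (lits α′) (All.map beyond b′)))
    where beyond : ∀ {j} → j < n → j ≢ i
          beyond j<n refl = i≮n j<n

setIntv-forced : ∀ α t {i b} → forced (lits α) i ≡ just b → setIntv α t i ≡ b
setIntv-forced α t {i} e with forced (lits α) i
setIntv-forced α t refl | just _ = refl

writeIntv-forced : ∀ α h b t {i c} → forced (lits α) i ≡ just c → writeIntv α h b t i ≡ t i
writeIntv-forced α h b t {i} e with forced (lits α) i
writeIntv-forced α h b t refl | just _ = refl

writeIntv-here : ∀ α i b t → forced (lits α) i ≡ nothing → writeIntv α i b t i ≡ b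
writeIntv-here α i b t e with forced (lits α) i | i ≟ℕ i
writeIntv-here α i b t refl | nothing | yes _ = refl
writeIntv-here α i b t refl | nothing | no ne = ⊥-elim (ne refl)

writeIntv-other : ∀ α h b t i → h ≢ i → writeIntv α h b t i ≡ t i
writeIntv-other α h b t i ne with forced (lits α) i | h ≟ℕ i
... | just _ | _ = refl
... | nothing | yes e = ⊥-elim (ne e)
... | nothing | no _ = refl

writeIntv-cong : ∀ α h b {t u} → t ≗ u → writeIntv α h b t ≗ writeIntv α h b u
writeIntv-cong α h b e i with forced (lits α) i | h ≟ℕ i
... | just _ | _ = e i
... | nothing | yes _ = refl
... | nothing | no _ = e i

writeIntv-same : ∀ α h t → writeIntv α h (t h) t ≗ t
writeIntv-same α h t i with forced (lits α) i | h ≟ℕ i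
... | just _ | _ = refl
... | nothing | yes refl = refl
... | nothing | no _ = refl

RespectsIntv : Intv → Tape → Set
RespectsIntv α t = ∀ {i b} → forced (lits α) i ≡ just b → t i ≡ b

Reach-respectsIntv : ∀ {T α x c} → Reach T α x c → RespectsIntv α (tape c)
Reach-respectsIntv {α = α} {x} r = go r (setIntv-forced α x)
  where
  go : ∀ {T c c′} → Star (Step T α) c c′ → RespectsIntv α (tape c) → RespectsIntv α (tape c′)
  go ε ok = ok
  go (step {h = h} {t = t} {b = b} _ _ ◅ r) ok = go r λ e → trans (writeIntv-forced α h b t e) (ok e)

Holds-litForm : ∀ t i b → Holds t (litForm (i , b)) ⇔ (t i ≡ b)
Holds-litForm t i true = mk⇔ (λ e → e) (λ e → e)
Holds-litForm t i false with t i
... | true = mk⇔ (λ ()) (λ ())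
... | false = mk⇔ (λ _ → refl) (λ _ → refl)

Holds-conjLits⁺ : ∀ t ls → (∀ {i b} → (i , b) ∈ ls → t i ≡ b) → Holds t (conjLits ls)
Holds-conjLits⁺ t [] h = refl
Holds-conjLits⁺ t ((i , b) ∷ []) h = from (Holds-litForm t i b) (h (here refl))
Holds-conjLits⁺ t ((i , b) ∷ l′ ∷ ls) h =
  ∧I t (litForm (i , b)) (conjLits (l′ ∷ ls)) (from (Holds-litForm t i b) (h (here refl)))
     (Holds-conjLits⁺ t (l′ ∷ ls) λ m → h (there m))

Holds-conjLits⁻ : ∀ t ls → Holds t (conjLits ls) → ∀ {i b} → (i , b) ∈ ls → t i ≡ b
Holds-conjLits⁻ t ((i , b) ∷ []) e (here refl) = to (Holds-litForm t i b) e
Holds-conjLits⁻ t ((i , b) ∷ l′ ∷ ls) e (here refl) =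
  to (Holds-litForm t i b) (∧E₁ t (litForm (i , b)) (conjLits (l′ ∷ ls)) e)
Holds-conjLits⁻ t ((i , b) ∷ l′ ∷ ls) e (there m) =
  Holds-conjLits⁻ t (l′ ∷ ls) (∧E₂ t (litForm (i , b)) (conjLits (l′ ∷ ls)) e) m

Step-nonhalting : ∀ {T α c c′} → Step T α c c′ → halt T (state c) ≡ false
Step-nonhalting (step e _) = e

Step-deterministic : ∀ {T α c c₁ c₂} → Deterministic T →
  Step T α c c₁ → Step T α c c₂ → c₁ ≡ c₂
Step-deterministic {T} {α} det (step {q = q} {h = h} {t = t} _ m₁) (step _ m₂) =
  cong (λ (q′ , b , m) → cfg q′ (move m h) (writeIntv α h b t)) (singleton m₁ m₂)
  where
  singleton : ∀ {y z} → y ∈ toList (δ T q (t h)) → z ∈ toList (δ T q (t h)) → y ≡ z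
  singleton m₁ m₂ with δ T q (t h) | det q (t h)
  singleton (here refl) (here refl) | _ ∷⁺ [] | refl = refl

halting-unique : ∀ {T α a c₁ c₂} → Deterministic T →
  Star (Step T α) a c₁ → halt T (state c₁) ≡ true →
  Star (Step T α) a c₂ → halt T (state c₂) ≡ true → c₁ ≡ c₂
halting-unique det ε h₁ ε h₂ = refl
halting-unique det ε h₁ (s ◅ r) h₂ with () ← trans (sym h₁) (Step-nonhalting s)
halting-unique det (s ◅ r) h₁ ε h₂ with () ← trans (sym h₂) (Step-nonhalting s)
halting-unique det (s₁ ◅ r₁) h₁ (s₂ ◅ r₂) h₂ with refl ← Step-deterministic det s₁ s₂ =
  halting-unique det r₁ h₁ r₂ h₂

halting-exists : ∀ {T α} c → AllHalt T α c →
  ∃ λ c′ → Star (Step T α) c c′ × halt T (state c′) ≡ true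
halting-exists {T} (cfg q h t) (acc rs) with halt T q in e
... | true = cfg q h t , ε , e
... | false with halting-exists _ (rs (step {T = T} {q = q} {h = h} {t = t} e (here refl)))
...   | c′ , r , hc = c′ , step e (here refl) ◅ r , hc

idle : TM
idle = record { nQ = 1 ; start = zero ; halt = λ _ → true ; δ = λ _ b → (zero , b , S) ∷⁺ [] }

idle-inClassFin : ∀ det hlt x (fin : FinSupp x) → InClassFin det hlt ⟨ idle , x , fin ⟩
idle-inClassFin det hlt x fin =
  (λ _ _ _ → refl) ,
  (λ _ _ _ _ → acc λ { (step () _) }) ,
  (1 , λ { _ _ _ _ ε → s≤s z≤n ; _ _ _ _ (step () _ ◅ _) })

restrict : ℕ → Tape → Tape
restrict N t i with i <? N
... | yes _ = t i
... | no _ = false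

restrict-< : ∀ N t {i} → i < N → restrict N t i ≡ t i
restrict-< N t {i} i<N with i <? N
... | yes _ = refl
... | no i≮N = ⊥-elim (i≮N i<N)

restrict-finite : ∀ N t → FinSupp (restrict N t)
restrict-finite N t = N , beyond
  where
  beyond : ∀ i → N ≤ i → restrict N t i ≡ false
  beyond i N≤i with i <? N
  ... | yes i<N = ⊥-elim (<⇒≱ i<N N≤i)
  ... | no _ = refl

-- Deliberately not suc (max 0 is): with a visible suc, the list upTo (suc n) of the
-- machine's states below would start unfolding during type checking.
bound : List ℕ → ℕ
bound is = max 0 (map suc is)

<-bound : ∀ {i} is → i ∈ is → i < bound is
<-bound is m = All.lookup (xs≤max 0 (map suc is)) (∈-map⁺ suc m)

atoms-mapFm : ∀ {A B : Set} (f : A → B) φ → atoms (mapFm f φ) ≡ map f (atoms φ)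
atoms-mapFm f (atom a) = refl
atoms-mapFm f ⊤̇ = refl
atoms-mapFm f (¬̇ φ) = atoms-mapFm f φ
atoms-mapFm f (φ ∧̇ ψ) =
  trans (cong₂ _++_ (atoms-mapFm f φ) (atoms-mapFm f ψ)) (sym (List.map-++ f (atoms φ) (atoms ψ)))
atoms-mapFm f (φ ∨̇ ψ) =
  trans (cong₂ _++_ (atoms-mapFm f φ) (atoms-mapFm f ψ)) (sym (List.map-++ f (atoms φ) (atoms ψ)))

Sat-ι : ∀ M β → Sat M (ι β) ⇔ Holds (x M) β
Sat-ι M β = subst (λ b → Sat M (ι β) ⇔ (b ≡ true)) (evalB-mapFm X v β) (Sat⇔Holds M v (ι β) agree)
  where
  v : Atom → Bool
  v (X i) = x M i
  v (box _ _) = false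
  agree : ∀ a → a ∈ atoms (ι β) → Agree M v a
  agree a m with ∈-map⁻ X (subst (a ∈_) (atoms-mapFm X β) m)
  ... | i , _ , refl = mk⇔ (λ e → e) (λ e → e)

Valid : Bool → Bool → Form → Set
Valid det hlt φ = ∀ M → InClassFin det hlt M → Sat M φ

Valid-ι : ∀ det hlt β → Valid det hlt (ι β) → ∀ t → Holds t β
Valid-ι det hlt β valid t =
  trans (evalB-cong t (restrict N t) β λ i m → sym (restrict-< N t (<-bound (atoms β) m)))
        (to (Sat-ι M β) (valid M (idle-inClassFin det hlt _ (restrict-finite N t))))
  where
  N = bound (atoms β)
  M = ⟨ idle , restrict N t , restrict-finite N t ⟩

sound : ∀ {det hlt φ} → AX[ det , hlt ]⊢ φ → Valid det hlt φ
sound (pc-taut t) M _ = Sat-tautology M _ t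
sound (pc-mp {φ} {ψ} p q) M c = Sat-⇒⁻ M φ ψ (sound p M c) (sound q M c)
sound {det} {hlt} (RW {α} {β} {β′} p) M _ = Sat-⇒⁺ M ([ α ] β) ([ α ] β′) λ h c hr →
  ⇒E (tape c) β β′ (Valid-ι det hlt (β ⇒̇ β′) (sound p) (tape c)) (h c hr)
sound (R {α}) M _ c (r , _) =
  Holds-conjLits⁺ (tape c) (lits α) λ m → Reach-respectsIntv r (forced-∈ (sorted α) m)
sound (K {α} {β} {γ}) M _ =
  Sat-⇒⁺ M ([ α ] (β ⇒̇ γ)) ([ α ] β ⇒̇ [ α ] γ) λ h₁ →
  Sat-⇒⁺ M ([ α ] β) ([ α ] γ) λ h₂ c hr → ⇒E (tape c) β γ (h₁ c hr) (h₂ c hr)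
sound (F {α} {β} refl) M (det , _ , _) = Sat-⇒⁺ M (⟨ α ⟩ β) ([ α ] β) only
  where
  only : Sat M (⟨ α ⟩ β) → Sat M ([ α ] β)
  only ¬box¬ c (r , h) with holds? (tape c) β
  ... | yes p = p
  ... | no ¬p = ⊥-elim (¬box¬ λ c′ (r′ , h′) →
          subst (λ c → Holds (tape c) (¬̇ β)) (halting-unique (det refl) r h r′ h′)
                (¬I (tape c) β ¬p))
sound (D {α} {β} refl) M (_ , halts , _) = Sat-⇒⁺ M ([ α ] β) (⟨ α ⟩ β) λ h h¬ →
  ¬E (tape c) β (h¬ c hr) (h c hr)
  where
  run = halting-exists (initCfg (T M) α (x M)) (halts refl α (x M) (finite M))
  c = proj₁ run
  hr : HaltingRun (T M) α (x M) c
  hr = proj₂ run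

Witness : Intv → List PForm → List PForm → Tape → Set
Witness α P N t = Holds t (intvForm α) × All (Holds t) P × All (λ γ → ¬ Holds t γ) N

witnessFormula : Intv → List PForm → List PForm → PForm
witnessFormula α P N = intvForm α ∧̇ (⋀ P ∧̇ ⋀ (map ¬̇_ N))

Holds-witnessFormula : ∀ α P N t → Holds t (witnessFormula α P N) ⇔ Witness α P N t
Holds-witnessFormula α P N t = mk⇔
  (λ h → ∧E₁ t a rest h , Holds-⋀⁻ t P (∧E₁ t (⋀ P) ¬N (∧E₂ t a rest h)) ,
         refuted N (Holds-⋀⁻ t (map ¬̇_ N) (∧E₂ t (⋀ P) ¬N (∧E₂ t a rest h))))
  (λ (h , hP , hN) →
     ∧I t a rest h (∧I t (⋀ P) ¬N (Holds-⋀⁺ t P hP) (Holds-⋀⁺ t (map ¬̇_ N) (negated N hN))))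
  where
  a = intvForm α
  ¬N = ⋀ (map ¬̇_ N)
  rest = ⋀ P ∧̇ ¬N
  refuted : ∀ N → All (Holds t) (map ¬̇_ N) → All (λ γ → ¬ Holds t γ) N
  refuted [] [] = []
  refuted (γ ∷ N) (h ∷ hs) = ¬E t γ h ∷ refuted N hs
  negated : ∀ N → All (λ γ → ¬ Holds t γ) N → All (Holds t) (map ¬̇_ N)
  negated [] [] = []
  negated (γ ∷ N) (h ∷ hs) = ¬I t γ h ∷ negated N hs

module Derivable (det hlt : Bool) where

  ⊢_ : Form → Set
  ⊢ φ = AX[ det , hlt ]⊢ φ

  ⊢⋀ : ∀ φs → All ⊢_ φs → ⊢ ⋀ φs
  ⊢⋀ [] [] = pc-taut λ v → refl
  ⊢⋀ (φ ∷ φs) (p ∷ ps) = pc-mp (pc-mp (pc-taut pair) p) (⊢⋀ φs ps)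
    where
    pair : Tautology (φ ⇒̇ (⋀ φs ⇒̇ φ ∧̇ ⋀ φs))
    pair v = ⇒I v φ (⋀ φs ⇒̇ φ ∧̇ ⋀ φs) λ a →
             ⇒I v (⋀ φs) (φ ∧̇ ⋀ φs) λ b → ∧I v φ (⋀ φs) a b

  ⊢-consequence : ∀ {φs ψ} → All ⊢_ φs → (∀ v → All (Holds v) φs → Holds v ψ) → ⊢ ψ
  ⊢-consequence {φs} {ψ} ps h =
    pc-mp (pc-taut λ v → ⇒I v (⋀ φs) ψ λ e → h v (Holds-⋀⁻ v φs e)) (⊢⋀ φs ps)

  ⊢RW : ∀ {α} β β′ → (∀ t → Holds t β → Holds t β′) → ⊢ ([ α ] β ⇒̇ [ α ] β′)
  ⊢RW β β′ h = RW (pc-taut λ v → trans (evalB-mapFm X v (β ⇒̇ β′)) (⇒I _ β β′ (h _)))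

  □⋀ : Intv → List PForm → Form
  □⋀ α βs = ⋀ (map ([ α ]_) βs)

  □⋁ : Intv → List PForm → Form
  □⋁ α βs = ⋁ (map ([ α ]_) βs)

  ⊢□⋀ : ∀ α βs → ⊢ (□⋀ α βs ⇒̇ [ α ] (intvForm α ∧̇ ⋀ βs))
  ⊢□⋀ α [] = ⊢-consequence (R ∷ ⊢RW a ψ (λ t e → ∧I t a ⊤̇ e refl) ∷ [])
    λ { v (r ∷ rw ∷ []) → ⇒I v ⊤̇ ([ α ] ψ) λ _ → ⇒E v ([ α ] a) ([ α ] ψ) rw r }
    where
    a = intvForm α
    ψ = a ∧̇ ⊤̇
  ⊢□⋀ α (β ∷ βs) =
    ⊢-consequence (⊢□⋀ α βs ∷ ⊢RW ψ (β ⇒̇ ψ′) add ∷ K {γ = ψ′} ∷ [])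
    λ { v (ih ∷ rw ∷ k ∷ []) → ⇒I v (□⋀ α (β ∷ βs)) ([ α ] ψ′) λ h →
          let □β = ∧E₁ v ([ α ] β) (□⋀ α βs) h
              □ψ = ⇒E v (□⋀ α βs) ([ α ] ψ) ih (∧E₂ v ([ α ] β) (□⋀ α βs) h)
              □β⇒ψ′ = ⇒E v ([ α ] ψ) ([ α ] (β ⇒̇ ψ′)) rw □ψ
              □β⇒□ψ′ = ⇒E v ([ α ] (β ⇒̇ ψ′)) ([ α ] β ⇒̇ [ α ] ψ′) k □β⇒ψ′
          in ⇒E v ([ α ] β) ([ α ] ψ′) □β⇒□ψ′ □β }
    where
    ψ = intvForm α ∧̇ ⋀ βs
    ψ′ = intvForm α ∧̇ (β ∧̇ ⋀ βs)
    add : ∀ t → Holds t ψ → Holds t (β ⇒̇ ψ′)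
    add t e = ⇒I t β ψ′ λ b →
      ∧I t (intvForm α) (β ∧̇ ⋀ βs) (∧E₁ t (intvForm α) (⋀ βs) e)
         (∧I t β (⋀ βs) b (∧E₂ t (intvForm α) (⋀ βs) e))

  Unsatisfiable : Intv → List PForm → List PForm → Set
  Unsatisfiable α P N = ∀ t → ¬ Witness α P N t

  BoxRule : Intv → List PForm → List PForm → Form
  BoxRule α P N = □⋀ α P ⇒̇ □⋁ α N

  ⊢□-entailed : ∀ {α} P γ → Unsatisfiable α P (γ ∷ []) →
    ⊢ ([ α ] (intvForm α ∧̇ ⋀ P) ⇒̇ [ α ] γ)
  ⊢□-entailed {α} P γ u = ⊢RW (intvForm α ∧̇ ⋀ P) γ entailed
    where
    entailed : ∀ t → Holds t (intvForm α ∧̇ ⋀ P) → Holds t γ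
    entailed t e with holds? t γ
    ... | yes g = g
    ... | no ¬g = ⊥-elim (u t (∧E₁ t (intvForm α) (⋀ P) e ,
                                 Holds-⋀⁻ t P (∧E₂ t (intvForm α) (⋀ P) e) , ¬g ∷ []))

  ⊢BoxRule-single : ∀ α P γ → Unsatisfiable α P (γ ∷ []) → ⊢ BoxRule α P (γ ∷ [])
  ⊢BoxRule-single α P γ u = ⊢-consequence (⊢□⋀ α P ∷ ⊢□-entailed P γ u ∷ [])
    λ { v (c ∷ e ∷ []) → ⇒I v (□⋀ α P) (□⋁ α (γ ∷ [])) λ h →
          ∨I₁ v ([ α ] γ) (¬̇ ⊤̇) (⇒E v ([ α ] ψ) ([ α ] γ) e (⇒E v (□⋀ α P) ([ α ] ψ) c h)) }
    where ψ = intvForm α ∧̇ ⋀ P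

  -- With D, a box is never vacuous, so [α] of an unsatisfiable formula is refutable.
  ⊢BoxRule-empty : ∀ α P → hlt ≡ true → Unsatisfiable α P [] → ⊢ BoxRule α P []
  ⊢BoxRule-empty α P refl u =
    ⊢-consequence (⊢□⋀ α P ∷ ⊢□-entailed P (¬̇ ⊤̇) u′ ∷ D {α = α} {β = ¬̇ ⊤̇} refl ∷
                   R ∷ ⊢RW (intvForm α) (¬̇ (¬̇ ⊤̇)) (λ _ _ → refl) ∷ [])
    λ { v (c ∷ e ∷ d ∷ r ∷ rw ∷ []) → ⇒I v (□⋀ α P) (¬̇ ⊤̇) λ h →
          let □⊥ = ⇒E v ([ α ] ψ) ([ α ] ⊥̇) e (⇒E v (□⋀ α P) ([ α ] ψ) c h)
          in ⊥-elim (¬E v ([ α ] (¬̇ ⊥̇)) (⇒E v ([ α ] ⊥̇) (⟨ α ⟩ ⊥̇) d □⊥)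
                       (⇒E v ([ α ] intvForm α) ([ α ] (¬̇ ⊥̇)) rw r)) }
    where
    ⊥̇ = ¬̇ ⊤̇
    ψ = intvForm α ∧̇ ⋀ P
    u′ : Unsatisfiable α P (¬̇ ⊤̇ ∷ [])
    u′ t (a , ps , _) = u t (a , ps , [])

  ⊢¬□⇒□¬ : ∀ α γ → det ≡ true → ⊢ (¬̇ [ α ] γ ⇒̇ [ α ] (¬̇ γ))
  ⊢¬□⇒□¬ α γ refl =
    ⊢-consequence (F {α = α} {β = ¬̇ γ} refl ∷ ⊢RW (¬̇ (¬̇ γ)) γ dne ∷ [])
    λ { v (f ∷ rw ∷ []) → ⇒I v (¬̇ [ α ] γ) ([ α ] (¬̇ γ)) λ h →
          ⇒E v (⟨ α ⟩ (¬̇ γ)) ([ α ] (¬̇ γ)) f (¬I v ([ α ] (¬̇ (¬̇ γ))) λ h′ →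
            ¬E v ([ α ] γ) h (⇒E v ([ α ] (¬̇ (¬̇ γ))) ([ α ] γ) rw h′)) }
    where
    dne : ∀ t → Holds t (¬̇ (¬̇ γ)) → Holds t γ
    dne t h with holds? t γ
    ... | yes g = g
    ... | no ¬g = ⊥-elim (¬E t (¬̇ γ) h (¬I t γ ¬g))

  -- With F, a box that fails has its negation boxed, which joins the premises.
  ⊢BoxRule-many : ∀ α P γ N → det ≡ true → Unsatisfiable α P (γ ∷ N) →
    ⊢ BoxRule α P (γ ∷ N)
  ⊢BoxRule-many α P γ [] _ u = ⊢BoxRule-single α P γ u
  ⊢BoxRule-many α P γ (γ′ ∷ N) d u =
    ⊢-consequence (⊢BoxRule-many α (¬̇ γ ∷ P) γ′ N d u′ ∷ ⊢¬□⇒□¬ α γ d ∷ [])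
    λ { v (ih ∷ f ∷ []) → ⇒I v (□⋀ α P) (□⋁ α (γ ∷ γ′ ∷ N)) λ h →
          case v ih f h (holds? v ([ α ] γ)) }
    where
    u′ : Unsatisfiable α (¬̇ γ ∷ P) (γ′ ∷ N)
    u′ t (a , ¬g ∷ ps , rs) = u t (a , ps , (λ g → ¬E t γ ¬g g) ∷ rs)
    case : ∀ v → Holds v (BoxRule α (¬̇ γ ∷ P) (γ′ ∷ N)) →
      Holds v (¬̇ [ α ] γ ⇒̇ [ α ] (¬̇ γ)) → Holds v (□⋀ α P) →
      Dec (Holds v ([ α ] γ)) → Holds v (□⋁ α (γ ∷ γ′ ∷ N))
    case v ih f h (yes g) = ∨I₁ v ([ α ] γ) (□⋁ α (γ′ ∷ N)) g
    case v ih f h (no ¬g) = ∨I₂ v ([ α ] γ) (□⋁ α (γ′ ∷ N))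
      (⇒E v (□⋀ α (¬̇ γ ∷ P)) (□⋁ α (γ′ ∷ N)) ih
        (∧I v ([ α ] (¬̇ γ)) (□⋀ α P)
           (⇒E v (¬̇ [ α ] γ) ([ α ] (¬̇ γ)) f (¬I v ([ α ] γ) ¬g)) h))

∈-concatMap : ∀ {A B : Set} (f : A → List B) {x xs y} → x ∈ xs → y ∈ f x → y ∈ concatMap f xs
∈-concatMap f m m′ = ∈-concatMap⁺ f (lose m m′)

∈-concatMap⁻′ : ∀ {A B : Set} (f : A → List B) xs {y} → y ∈ concatMap f xs →
  ∃ λ x → x ∈ xs × y ∈ f x
∈-concatMap⁻′ f xs m = find (∈-concatMap⁻ f m)

listsOf : ∀ {A : Set} → List A → ℕ → List (List A)
listsOf as zero = [] ∷ []
listsOf as (suc k) = concatMap (λ a → map (a ∷_) (listsOf as k)) as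

∈-listsOf : ∀ {A : Set} {as : List A} → (∀ a → a ∈ as) → ∀ xs → xs ∈ listsOf as (length xs)
∈-listsOf all [] = here refl
∈-listsOf {as = as} all (a ∷ xs) = ∈-concatMap _ (all a) (∈-map⁺ (a ∷_) (∈-listsOf all xs))

listsOf-length : ∀ {A : Set} (as : List A) k {xs} → xs ∈ listsOf as k → length xs ≡ k
listsOf-length as zero (here refl) = refl
listsOf-length as (suc k) m with ∈-concatMap⁻′ _ as m
... | a , _ , m′ with ∈-map⁻ (a ∷_) m′
...   | xs , m″ , refl = cong suc (listsOf-length as k m″)

listsUpTo : ∀ {A : Set} → List A → ℕ → List (List A)
listsUpTo as n = concatMap (listsOf as) (upTo (suc n))

∈-listsUpTo : ∀ {A : Set} {as : List A} → (∀ a → a ∈ as) →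
  ∀ {n} xs → length xs ≤ n → xs ∈ listsUpTo as n
∈-listsUpTo {as = as} all xs le = ∈-concatMap (listsOf as) (∈-upTo⁺ (s≤s le)) (∈-listsOf all xs)

bools : List Bool
bools = false ∷ true ∷ []

∈-bools : ∀ b → b ∈ bools
∈-bools false = here refl
∈-bools true = there (here refl)

words : ℕ → List (List Bool)
words = listsOf bools

-- A word w occupies cells 0 … length w - 1, its first letter on the last of them.
toTape : List Bool → Tape
toTape [] i = false
toTape (c ∷ w) i with i ≟ℕ length w
... | yes _ = c
... | no _ = toTape w i

toTape-here : ∀ c w → toTape (c ∷ w) (length w) ≡ c
toTape-here c w with length w ≟ℕ length w
... | yes _ = refl
... | no ne = ⊥-elim (ne refl)

toTape-other : ∀ c w {i} → i ≢ length w → toTape (c ∷ w) i ≡ toTape w i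
toTape-other c w {i} ne with i ≟ℕ length w
... | yes e = ⊥-elim (ne e)
... | no _ = refl

fromTape : ℕ → Tape → List Bool
fromTape zero s = []
fromTape (suc k) s = s k ∷ fromTape k s

length-fromTape : ∀ k s → length (fromTape k s) ≡ k
length-fromTape zero s = refl
length-fromTape (suc k) s = cong suc (length-fromTape k s)

fromTape-∈-words : ∀ k s → fromTape k s ∈ words k
fromTape-∈-words k s = subst (λ m → fromTape k s ∈ words m) (length-fromTape k s) (∈-listsOf ∈-bools _)

toTape-fromTape : ∀ k s {i} → i < k → toTape (fromTape k s) i ≡ s i
toTape-fromTape (suc k) s {i} i<1+k with i ≟ℕ length (fromTape k s)
... | yes e = cong s (sym (trans e (length-fromTape k s)))
... | no ne =
  toTape-fromTape k s (≤∧≢⇒< (≤-pred i<1+k) λ e → ne (trans e (sym (length-fromTape k s))))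

evalB-fromTape : ∀ k s β → (∀ i → i ∈ atoms β → i < k) →
  evalB (toTape (fromTape k s)) β ≡ evalB s β
evalB-fromTape k s β below = evalB-cong _ s β λ i m → toTape-fromTape k s (below i m)

satisfiable? : ∀ β → (∃ λ t → Holds t β) ⊎ (∀ t → ¬ Holds t β)
satisfiable? β with any? (λ w → evalB (toTape w) β ≟ᵇ true) (words (bound (atoms β)))
... | yes w∈ = let w , _ , h = find w∈ in inj₁ (toTape w , h)
... | no none = inj₂ λ t h →
  none (lose (fromTape-∈-words (bound (atoms β)) t)
             (trans (evalB-fromTape (bound (atoms β)) t β λ i → <-bound (atoms β)) h))

writeWord : Intv → List Bool → Tape → Tape
writeWord α [] t = t
writeWord α (c ∷ w) t = writeWord α w (writeIntv α (length w) c t)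

writeWord-cong : ∀ α w {t u} → t ≗ u → writeWord α w t ≗ writeWord α w u
writeWord-cong α [] e = e
writeWord-cong α (c ∷ w) e = writeWord-cong α w (writeIntv-cong α (length w) c e)

writeWord-≥ : ∀ α w t {i} → length w ≤ i → writeWord α w t i ≡ t i
writeWord-≥ α [] t le = refl
writeWord-≥ α (c ∷ w) t {i} le =
  trans (writeWord-≥ α w _ (≤-trans (n≤1+n _) le))
        (writeIntv-other α (length w) c t i λ e → <-irrefl e le)

writeWord-forced : ∀ α w t {i b} → forced (lits α) i ≡ just b → writeWord α w t i ≡ t i
writeWord-forced α [] t e = refl
writeWord-forced α (c ∷ w) t {i} e = trans (writeWord-forced α w _ e) (writeIntv-forced α (length w) c t e)

writeWord-free : ∀ α w t {i} → i < length w → forced (lits α) i ≡ nothing →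
  writeWord α w t i ≡ toTape w i
writeWord-free α (c ∷ w) t {i} i<1+w e with m≤n⇒m<n∨m≡n (≤-pred i<1+w)
... | inj₁ i<w = trans (writeWord-free α w _ i<w e) (sym (toTape-other c w (<⇒≢ i<w)))
... | inj₂ refl =
  trans (writeWord-≥ α w _ ≤-refl) (trans (writeIntv-here α i c t e) (sym (toTape-here c w)))

-- The lists of failed boxes that one halting run has to refute simultaneously: with F
-- there is only one run, so it refutes them all; without F each may get its own run;
-- with D some run must exist even when nothing fails.
demands : Bool → Bool → List PForm → List (List PForm)
demands true true N = N ∷ []
demands true false [] = []
demands true false (γ ∷ N) = (γ ∷ N) ∷ []
demands false true N = map (_∷ []) N ++ ([] ∷ [])
demands false false N = map (_∷ []) N

demands-⊆ : ∀ det hlt N {rq γ} → rq ∈ demands det hlt N → γ ∈ rq → γ ∈ N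
demands-⊆ true true N (here refl) m = m
demands-⊆ true false (_ ∷ _) (here refl) m = m
demands-⊆ false true N r m with ∈-++⁻ (map (_∷ []) N) r
... | inj₁ r′ with ∈-map⁻ (_∷ []) r′
...   | γ , γ∈N , refl with here refl ← m = γ∈N
demands-⊆ false true N r () | inj₂ (here refl)
demands-⊆ false false N r m with ∈-map⁻ (_∷ []) r
... | γ , γ∈N , refl with here refl ← m = γ∈N

demand-refuting : ∀ det hlt N {β} → β ∈ N →
  ∃ λ rq → rq ∈ demands det hlt N × (det ≡ false → rq ≡ β ∷ []) × (det ≡ true → rq ≡ N)
demand-refuting true true N m = N , here refl , (λ ()) , (λ _ → refl)
demand-refuting true false (γ ∷ N) m = γ ∷ N , here refl , (λ ()) , (λ _ → refl)
demand-refuting false true N {β} m = β ∷ [] , ∈-++⁺ˡ (∈-map⁺ (_∷ []) m) , (λ _ → refl) , (λ ())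
demand-refuting false false N {β} m = β ∷ [] , ∈-map⁺ (_∷ []) m , (λ _ → refl) , (λ ())

demand-halting : ∀ det N → ∃ λ rq → rq ∈ demands det true N × (det ≡ true → rq ≡ N)
demand-halting true N = N , here refl , λ _ → refl
demand-halting false N = [] , ∈-++⁺ʳ (map (_∷ []) N) (here refl) , λ ()

⊢BoxRule-demand : ∀ det hlt α P N {rq} → rq ∈ demands det hlt N →
  Derivable.Unsatisfiable det hlt α P rq → AX[ det , hlt ]⊢ Derivable.BoxRule det hlt α P rq
⊢BoxRule-demand true true α P [] (here refl) u = Derivable.⊢BoxRule-empty true true α P refl u
⊢BoxRule-demand true true α P (γ ∷ N) (here refl) u = Derivable.⊢BoxRule-many true true α P γ N refl u
⊢BoxRule-demand true false α P (γ ∷ N) (here refl) u = Derivable.⊢BoxRule-many true false α P γ N refl u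
⊢BoxRule-demand false true α P N r u with ∈-++⁻ (map (_∷ []) N) r
... | inj₁ r′ with ∈-map⁻ (_∷ []) r′
...   | γ , _ , refl = Derivable.⊢BoxRule-single false true α P γ u
⊢BoxRule-demand false true α P N r u | inj₂ (here refl) = Derivable.⊢BoxRule-empty false true α P refl u
⊢BoxRule-demand false false α P N r u with ∈-map⁻ (_∷ []) r
... | γ , _ , refl = Derivable.⊢BoxRule-single false false α P γ u

splits : ∀ {A : Set} → List A → List (List A × List A)
splits [] = ([] , []) ∷ []
splits (x ∷ xs) = concatMap (λ (P , N) → (x ∷ P , N) ∷ (P , x ∷ N) ∷ []) (splits xs)

splits-∈ : ∀ {A : Set} (p : A → Bool) xs →
  (filter (λ a → p a ≟ᵇ true) xs , filter (λ a → p a ≟ᵇ false) xs) ∈ splits xs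
splits-∈ p [] = here refl
splits-∈ p (x ∷ xs) with p x
... | true = ∈-concatMap _ (splits-∈ p xs) (here refl)
... | false = ∈-concatMap _ (splits-∈ p xs) (there (here refl))

mentioned : Atom → List ℕ
mentioned (X i) = i ∷ []
mentioned (box α β) = map proj₁ (lits α) ++ atoms β

boxesOf : List Atom → List (Intv × PForm)
boxesOf [] = []
boxesOf (X _ ∷ as) = boxesOf as
boxesOf (box α β ∷ as) = (α , β) ∷ boxesOf as

boxesOf-∈ : ∀ {α β} as → box α β ∈ as → (α , β) ∈ boxesOf as
boxesOf-∈ (box α β ∷ as) (here refl) = here refl
boxesOf-∈ (X _ ∷ as) (there m) = boxesOf-∈ as m
boxesOf-∈ (box _ _ ∷ as) (there m) = there (boxesOf-∈ as m)

boxesOf-∈⁻ : ∀ {α β} as → (α , β) ∈ boxesOf as → box α β ∈ as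
boxesOf-∈⁻ (X _ ∷ as) m = there (boxesOf-∈⁻ as m)
boxesOf-∈⁻ (box α β ∷ as) (here refl) = here refl
boxesOf-∈⁻ (box _ _ ∷ as) (there m) = there (boxesOf-∈⁻ as m)

module Canonical (det hlt : Bool) (φ : Form) where
  open Derivable det hlt

  n : ℕ
  n = bound (concatMap mentioned (atoms φ))

  mentioned-< : ∀ {a i} → a ∈ atoms φ → i ∈ mentioned a → i < n
  mentioned-< m mi = <-bound _ (∈-concatMap mentioned m mi)

  boxes : List (Intv × PForm)
  boxes = boxesOf (atoms φ)

  box-indices : ∀ {α β} → (α , β) ∈ boxes → IndicesBelow n α
  box-indices m = All.tabulate λ ml → mentioned-< (boxesOf-∈⁻ _ m) (∈-++⁺ˡ (∈-map⁺ proj₁ ml))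

  box-vars : ∀ {α β} → (α , β) ∈ boxes → ∀ i → i ∈ atoms β → i < n
  box-vars {α} m i mi = mentioned-< (boxesOf-∈⁻ _ m) (∈-++⁺ʳ (map proj₁ (lits α)) mi)

  boxed : Intv → List PForm
  boxed α = map proj₂ (filter (λ (α′ , _) → α′ ≟ᴵ α) boxes)

  ∈-boxed : ∀ {α β} → (α , β) ∈ boxes → β ∈ boxed α
  ∈-boxed m = ∈-map⁺ proj₂ (∈-filter⁺ (λ (α′ , _) → α′ ≟ᴵ _) m refl)

  instanceFor : Intv → List PForm × List PForm → List PForm → Form
  instanceFor α (P , N) rq with satisfiable? (witnessFormula α P rq)
  ... | inj₁ _ = ⊤̇
  ... | inj₂ _ = BoxRule α P rq

  ⊢instanceFor : ∀ α P N {rq} → rq ∈ demands det hlt N → ⊢ instanceFor α (P , N) rq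
  ⊢instanceFor α P N {rq} r with satisfiable? (witnessFormula α P rq)
  ... | inj₁ _ = pc-taut λ v → refl
  ... | inj₂ u = ⊢BoxRule-demand det hlt α P N r λ t w → u t (from (Holds-witnessFormula α P rq t) w)

  instancesFor : Intv → List Form
  instancesFor α = concatMap (λ (P , N) → map (instanceFor α (P , N)) (demands det hlt N)) (splits (boxed α))

  Γ : List Form
  Γ = concatMap instancesFor (map proj₁ boxes)

  ⊢Γ : ⊢ ⋀ Γ
  ⊢Γ = ⊢⋀ Γ (All.tabulate derivable)
    where
    derivable : ∀ {ψ} → ψ ∈ Γ → ⊢ ψ
    derivable m with ∈-concatMap⁻′ instancesFor (map proj₁ boxes) m
    ... | α , _ , m′ with ∈-concatMap⁻′ _ (splits (boxed α)) m′
    ...   | (P , N) , _ , m″ with ∈-map⁻ (instanceFor α (P , N)) m″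
    ...     | rq , r , refl = ⊢instanceFor α P N r

  module Valuation (v : Atom → Bool) (vΓ : Holds v (⋀ Γ)) where

    holding failing : Intv → List PForm
    holding α = filter (λ β → v (box α β) ≟ᵇ true) (boxed α)
    failing α = filter (λ β → v (box α β) ≟ᵇ false) (boxed α)

    -- The instance of Γ for this split and rq is not the box rule, whose premises v makes
    -- true and whose conclusion v makes false; so it is ⊤ and a witness exists.
    witness : ∀ {α} → α ∈ map proj₁ boxes → ∀ {rq} → rq ∈ demands det hlt (failing α) →
      ∃ (Witness α (holding α) rq)
    witness {α} mα {rq} r
      with All.lookup (Holds-⋀⁻ v Γ vΓ)
             (∈-concatMap instancesFor mα
               (∈-concatMap _ (splits-∈ (λ β → v (box α β)) (boxed α)) (∈-map⁺ _ r)))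
    ... | instance-holds with satisfiable? (witnessFormula α (holding α) rq)
    ...   | inj₁ (t , h) = t , to (Holds-witnessFormula α (holding α) rq t) h
    ...   | inj₂ _ = ⊥-elim (none-holds rq (demands-⊆ det hlt (failing α) r)
                              (Holds-⋁⁻ v (map ([ α ]_) rq)
                                (⇒E v (□⋀ α (holding α)) (□⋁ α rq) instance-holds all-hold)))
      where
      all-hold : Holds v (□⋀ α (holding α))
      all-hold = Holds-⋀⁺ v _ (All.map⁺ (All.tabulate λ m →
        proj₂ (∈-filter⁻ (λ β → v (box α β) ≟ᵇ true) {xs = boxed α} m)))
      none-holds : ∀ rs → (∀ {γ} → γ ∈ rs → γ ∈ failing α) →
        ¬ Any (Holds v) (map ([ α ]_) rs)
      none-holds (γ ∷ rs) ⊆ (here h) = false≢true (trans (sym fails) h)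
        where fails = proj₂ (∈-filter⁻ (λ β → v (box α β) ≟ᵇ false) {xs = boxed α} (⊆ (here refl)))
      none-holds (γ ∷ rs) ⊆ (there a) = none-holds rs (λ m → ⊆ (there m)) a

-- The machine first probes the cells 0 … n - 1 one by one, writing the negation of
-- the value read and reading it back, to learn the signature σ of the intervention
-- (restoring every cell afterwards); then it chooses a word of out σ, writes it
-- right to left and halts.
data State : Set where
  scan  : List (Maybe Bool) → State
  probe : List (Maybe Bool) → Bool → State
  emit  : List Bool → State
  loop  : State

halted : State → Bool
halted (emit []) = true
halted _ = false

detect : Bool → Bool → Maybe Bool
detect b b′ = if does (b′ ≟ᵇ b) then just b else nothing

detect-same : ∀ c → detect c c ≡ just c
detect-same true = refl
detect-same false = refl

detect-not : ∀ b → detect b (not b) ≡ nothing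
detect-not true = refl
detect-not false = refl

StateCode : Set
StateCode = (List (Maybe Bool) × Maybe Bool) ⊎ (List Bool ⊎ ⊤)

code : State → StateCode
code (scan σ) = inj₁ (σ , nothing)
code (probe σ b) = inj₁ (σ , just b)
code (emit w) = inj₂ (inj₁ w)
code loop = inj₂ (inj₂ tt)

decode : StateCode → State
decode (inj₁ (σ , nothing)) = scan σ
decode (inj₁ (σ , just b)) = probe σ b
decode (inj₂ (inj₁ w)) = emit w
decode (inj₂ (inj₂ tt)) = loop

decode-code : ∀ q → decode (code q) ≡ q
decode-code (scan σ) = refl
decode-code (probe σ b) = refl
decode-code (emit w) = refl
decode-code loop = refl

_≟ˢ_ : (q q′ : State) → Dec (q ≡ q′)
q ≟ˢ q′ = map′ (λ e → trans (sym (decode-code q)) (trans (cong decode e) (decode-code q′))) (cong code)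
  (Sum.≡-dec (Product.≡-dec (List.≡-dec (Maybe.≡-dec _≟ᵇ_)) (Maybe.≡-dec _≟ᵇ_))
             (Sum.≡-dec (List.≡-dec _≟ᵇ_) Unit._≟_) (code q) (code q′))

maybeBools : List (Maybe Bool)
maybeBools = nothing ∷ just false ∷ just true ∷ []

∈-maybeBools : ∀ a → a ∈ maybeBools
∈-maybeBools nothing = here refl
∈-maybeBools (just false) = there (here refl)
∈-maybeBools (just true) = there (there (here refl))

module Machine (n : ℕ) (out : List (Maybe Bool) → List (List Bool))
               (out-length : ∀ σ {w} → w ∈ out σ → length w ≡ n) where

  Action : Set
  Action = State × Bool × Move

  choose : List (Maybe Bool) → Bool → List⁺ Action
  choose σ b with out σ
  ... | [] = (loop , b , S) ∷⁺ []
  ... | w ∷ ws = (emit w , b , L) ∷⁺ map (λ w′ → (emit w′ , b , L)) ws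

  transition : State → Bool → List⁺ Action
  transition (scan σ) b with length σ <? n
  ... | yes _ = (probe σ b , not b , S) ∷⁺ []
  ... | no _ = choose σ b
  transition (probe σ b) b′ with length σ <? n
  ... | yes _ = (scan (detect b b′ ∷ σ) , b , R) ∷⁺ []
  ... | no _ = (emit [] , b′ , S) ∷⁺ []
  transition (emit []) b = (emit [] , b , S) ∷⁺ []
  transition (emit (c ∷ w)) b = (emit w , c , L) ∷⁺ []
  transition loop b = (loop , b , S) ∷⁺ []

  signatures : List (List (Maybe Bool))
  signatures = listsUpTo maybeBools n

  probes : List (Maybe Bool) → List State
  probes σ = probe σ false ∷ probe σ true ∷ []

  states : List State
  states = map scan signatures ++ concatMap probes signatures ++ map emit (listsUpTo bools n) ++ loop ∷ []

  scan-∈ : ∀ {σ} → length σ ≤ n → scan σ ∈ states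
  scan-∈ le = ∈-++⁺ˡ (∈-map⁺ scan (∈-listsUpTo ∈-maybeBools _ le))

  probe-∈ : ∀ {σ} b → length σ ≤ n → probe σ b ∈ states
  probe-∈ b le = ∈-++⁺ʳ (map scan signatures)
    (∈-++⁺ˡ (∈-concatMap probes (∈-listsUpTo ∈-maybeBools _ le) (∈probes b)))
    where
    ∈probes : ∀ {σ} b → probe σ b ∈ probes σ
    ∈probes false = here refl
    ∈probes true = there (here refl)

  emit-∈ : ∀ {w} → length w ≤ n → emit w ∈ states
  emit-∈ le = ∈-++⁺ʳ (map scan signatures) (∈-++⁺ʳ (concatMap probes signatures)
    (∈-++⁺ˡ (∈-map⁺ emit (∈-listsUpTo ∈-bools _ le))))

  loop-∈ : loop ∈ states
  loop-∈ = ∈-++⁺ʳ (map scan signatures) (∈-++⁺ʳ (concatMap probes signatures)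
    (∈-++⁺ʳ (map emit (listsUpTo bools n)) (here refl)))

  open import Data.List.Membership.DecPropositional _≟ˢ_ using () renaming (_∈?_ to _∈ˢ?_)

  encode : State → Fin (length states)
  encode q with q ∈ˢ? states
  ... | yes m = index m
  ... | no _ = zero

  decode-encode : ∀ {q} → q ∈ states → lookup states (encode q) ≡ q
  decode-encode {q} m with q ∈ˢ? states
  ... | yes m′ = sym (lookup-index m′)
  ... | no ∉ = ⊥-elim (∉ m)

  machine : TM
  machine = record
    { nQ = length states
    ; start = encode (scan [])
    ; halt = λ i → halted (lookup states i)
    ; δ = λ i b → List⁺.map (λ (q , c , m) → encode q , c , m) (transition (lookup states i) b)
    }

  transition-scan-< : ∀ {σ} b → length σ < n →
    transition (scan σ) b ≡ (probe σ b , not b , S) ∷⁺ []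
  transition-scan-< {σ} b lt with length σ <? n
  ... | yes _ = refl
  ... | no ≮ = ⊥-elim (≮ lt)

  transition-scan-≥ : ∀ {σ} b → ¬ length σ < n → transition (scan σ) b ≡ choose σ b
  transition-scan-≥ {σ} b ≮ with length σ <? n
  ... | yes lt = ⊥-elim (≮ lt)
  ... | no _ = refl

  transition-probe-< : ∀ {σ} b b′ → length σ < n →
    transition (probe σ b) b′ ≡ (scan (detect b b′ ∷ σ) , b , R) ∷⁺ []
  transition-probe-< {σ} b b′ lt with length σ <? n
  ... | yes _ = refl
  ... | no ≮ = ⊥-elim (≮ lt)

  choose-∈ : ∀ σ b {w} → w ∈ out σ → (emit w , b , L) ∈ toList (choose σ b)
  choose-∈ σ b m with out σ
  choose-∈ σ b (here refl) | w ∷ ws = here refl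
  choose-∈ σ b (there m) | w ∷ ws = there (∈-map⁺ (λ w′ → (emit w′ , b , L)) m)

  choose-∈⁻ : ∀ σ b {q c m} → (q , c , m) ∈ toList (choose σ b) →
    (out σ ≡ [] × q ≡ loop × c ≡ b × m ≡ S) ⊎
    (∃ λ w → w ∈ out σ × q ≡ emit w × c ≡ b × m ≡ L)
  choose-∈⁻ σ b mem with out σ
  choose-∈⁻ σ b (here refl) | [] = inj₁ (refl , refl , refl , refl)
  choose-∈⁻ σ b (here refl) | w ∷ ws = inj₂ (w , here refl , refl , refl , refl)
  choose-∈⁻ σ b (there mem) | w ∷ ws with ∈-map⁻ (λ w′ → (emit w′ , b , L)) mem
  ... | w′ , mw , refl = inj₂ (w′ , there mw , refl , refl , refl)

  move-L : ∀ k → move L k ≡ pred k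
  move-L zero = refl
  move-L (suc k) = refl

  module Run (α : Intv) (y : Tape) where

    x₀ : Tape
    x₀ = setIntv α y

    Invariant : State → ℕ → Tape → Set
    Invariant (scan σ) p t =
      σ ≡ signature (length σ) α × p ≡ length σ × length σ ≤ n × t ≗ x₀
    Invariant (probe σ b) p t =
      σ ≡ signature (length σ) α × p ≡ length σ × length σ < n × b ≡ x₀ p × t ≗ writeIntv α p (not b) x₀
    Invariant (emit w) p t = p ≡ pred (length w) × length w ≤ n ×
      ∃ λ w₀ → w₀ ∈ out (signature n α) × writeWord α w t ≗ writeWord α w₀ x₀
    Invariant loop p t = p ≤ n × out (signature n α) ≡ []

    detect-correct : ∀ p b t → b ≡ x₀ p → t ≗ writeIntv α p (not b) x₀ →
      detect b (t p) ≡ forced (lits α) p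
    detect-correct p b t eb et = by-cases (forced (lits α) p) refl
      where
      by-cases : ∀ r → forced (lits α) p ≡ r → detect b (t p) ≡ r
      by-cases (just c) ef = trans (cong₂ detect b≡c tp≡c) (detect-same c)
        where
        b≡c = trans eb (setIntv-forced α y ef)
        tp≡c = trans (et p) (trans (writeIntv-forced α p (not b) x₀ ef) (setIntv-forced α y ef))
      by-cases nothing ef =
        trans (cong (detect b) (trans (et p) (writeIntv-here α p (not b) x₀ ef))) (detect-not b)

    restore-correct : ∀ p b t → b ≡ x₀ p → t ≗ writeIntv α p (not b) x₀ →
      writeIntv α p b t ≗ x₀
    restore-correct p b t eb et i = by-position (p ≟ℕ i)
      where
      by-cases : ∀ r → forced (lits α) p ≡ r → writeIntv α p b t p ≡ x₀ p
      by-cases (just c) ef =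
        trans (writeIntv-forced α p b t ef) (trans (et p) (writeIntv-forced α p (not b) x₀ ef))
      by-cases nothing ef = trans (writeIntv-here α p b t ef) eb
      by-position : Dec (p ≡ i) → writeIntv α p b t i ≡ x₀ i
      by-position (yes refl) = by-cases (forced (lits α) p) refl
      by-position (no ne) =
        trans (writeIntv-other α p b t i ne) (trans (et i) (writeIntv-other α p (not b) x₀ i ne))

    invariant-step : ∀ q p t {q′ c m} → Invariant q p t → halted q ≡ false →
      (q′ , c , m) ∈ toList (transition q (t p)) →
      Invariant q′ (move m p) (writeIntv α p c t) × q′ ∈ states
    invariant-step (scan σ) p t (eσ , ep , le , et) hf mem with length σ <? n
    invariant-step (scan σ) p t (eσ , ep , le , et) hf (here refl) | yes lt =
      (eσ , ep , lt , et p , writeIntv-cong α p (not (t p)) et) , probe-∈ (t p) (<⇒≤ lt)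
    ... | no ≮ with choose-∈⁻ σ (t p) mem
    ...   | inj₁ (eo , refl , refl , refl) =
      (subst (_≤ n) (sym ep) le , subst (λ σ → out σ ≡ []) full eo) , loop-∈
      where full = trans eσ (cong (λ k → signature k α) (≤-antisym le (≮⇒≥ ≮)))
    ...   | inj₂ (w , mw , refl , refl , refl) =
      (trans (move-L p) (cong pred (trans ep (trans len (sym lw)))) , ≤-reflexive lw ,
       w , subst (λ σ → w ∈ out σ) full mw ,
       writeWord-cong α w λ i → trans (writeIntv-same α p t i) (et i)) ,
      emit-∈ (≤-reflexive lw)
      where
      len = ≤-antisym le (≮⇒≥ ≮)
      full = trans eσ (cong (λ k → signature k α) len)
      lw = out-length σ mw
    invariant-step (probe σ b) p t (eσ , ep , lt , eb , et) hf mem with length σ <? n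
    invariant-step (probe σ b) p t (eσ , ep , lt , eb , et) hf (here refl) | yes _ =
      (cong₂ _∷_ (trans (detect-correct p b t eb et) (cong (forced (lits α)) ep)) eσ ,
       cong suc ep , lt , restore-correct p b t eb et) , scan-∈ lt
    ... | no ≮ = ⊥-elim (≮ lt)
    invariant-step (emit (c ∷ w)) p t (ep , le , w₀ , m₀ , ew) hf (here refl) rewrite ep =
      (move-L (length w) , <⇒≤ le , w₀ , m₀ , ew) , emit-∈ (<⇒≤ le)
    invariant-step loop p t (le , eo) hf (here refl) = (le , eo) , loop-∈

    Invariantᶜ : Config machine → Set
    Invariantᶜ c = Invariant (lookup states (state c)) (pos c) (tape c)

    Step-transition : ∀ {c c′} → Step machine α c c′ →
      ∃ λ q′ → ∃ λ b → ∃ λ m →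
        (q′ , b , m) ∈ toList (transition (lookup states (state c)) (tape c (pos c))) ×
        halted (lookup states (state c)) ≡ false ×
        c′ ≡ cfg (encode q′) (move m (pos c)) (writeIntv α (pos c) b (tape c))
    Step-transition (step hf mem) with ∈-map⁻ (λ (q , c , m) → encode q , c , m) mem
    ... | (q′ , b , m) , mem′ , refl = q′ , b , m , mem′ , hf , refl

    Invariantᶜ-step : ∀ {c c′} → Step machine α c c′ → Invariantᶜ c → Invariantᶜ c′
    Invariantᶜ-step {c} s inv with Step-transition s
    ... | q′ , b , m , mem , hf , refl with invariant-step _ (pos c) (tape c) inv hf mem
    ...   | inv′ , q′∈ rewrite decode-encode q′∈ = inv′

    Reach-invariant : ∀ {c} → Reach machine α y c → Invariantᶜ c
    Reach-invariant r = go r init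
      where
      init : Invariantᶜ (initCfg machine α y)
      init rewrite decode-encode (scan-∈ {[]} z≤n) = refl , refl , z≤n , λ i → refl
      go : ∀ {c c′} → Star (Step machine α) c c′ → Invariantᶜ c → Invariantᶜ c′
      go ε inv = inv
      go (s ◅ r) inv = go r (Invariantᶜ-step s inv)

    HaltingRun-output : ∀ c → HaltingRun machine α y c →
      ∃ λ w → w ∈ out (signature n α) × tape c ≗ writeWord α w x₀
    HaltingRun-output c (r , h) with lookup states (state c) | Reach-invariant r
    HaltingRun-output c (r , refl) | emit [] | _ , _ , w , m , e = w , m , e

    invariant-pos : ∀ q p t → Invariant q p t → p ≤ n
    invariant-pos (scan σ) p t (_ , refl , le , _) = le
    invariant-pos (probe σ b) p t (_ , refl , lt , _) = <⇒≤ lt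
    invariant-pos (emit w) p t (refl , le , _) = ≤-trans pred[n]≤n le
    invariant-pos loop p t (le , _) = le

    Step-transition⁻ : ∀ {q p t q′ b m} → q ∈ states → halted q ≡ false →
      (q′ , b , m) ∈ toList (transition q (t p)) →
      Step machine α (cfg (encode q) p t) (cfg (encode q′) (move m p) (writeIntv α p b t))
    Step-transition⁻ {q} {p} {t} {q′} {b} {m} q∈ hf mem =
      step (subst (λ q → halted q ≡ false) (sym (decode-encode q∈)) hf)
           (subst (λ q → (encode q′ , b , m) ∈ toList (List⁺.map _ (transition q (t p))))
                  (sym (decode-encode q∈)) (∈-map⁺ _ mem))

    scan-cell : ∀ k t → k < n → t ≗ x₀ → ∃ λ t′ → t′ ≗ x₀ ×
      Star (Step machine α) (cfg (encode (scan (signature k α))) k t)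
                            (cfg (encode (scan (signature (suc k) α))) (suc k) t′)
    scan-cell k t k<n et =
      writeIntv α k b t₁ , restore-correct k b t₁ (et k) et₁ , write-¬b ◅ read-back ◅ ε
      where
      σ = signature k α
      b = t k
      t₁ = writeIntv α k (not b) t
      et₁ : t₁ ≗ writeIntv α k (not b) x₀
      et₁ = writeIntv-cong α k (not b) et
      lt : length σ < n
      lt = subst (_< n) (sym (length-signature k α)) k<n
      write-¬b : Step machine α (cfg (encode (scan σ)) k t) (cfg (encode (probe σ b)) k t₁)
      write-¬b = Step-transition⁻ (scan-∈ (<⇒≤ lt)) refl
        (subst (λ o → (probe σ b , not b , S) ∈ toList o) (sym (transition-scan-< b lt)) (here refl))
      read-back : Step machine α (cfg (encode (probe σ b)) k t₁)
                                 (cfg (encode (scan (signature (suc k) α))) (suc k) (writeIntv α k b t₁))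
      read-back = subst (λ r → Step machine α (cfg (encode (probe σ b)) k t₁)
                                               (cfg (encode (scan (r ∷ σ))) (suc k) (writeIntv α k b t₁)))
        (detect-correct k b t₁ (et k) et₁)
        (Step-transition⁻ (probe-∈ b (<⇒≤ lt)) refl
          (subst (λ o → (scan (detect b (t₁ k) ∷ σ) , b , R) ∈ toList o)
                 (sym (transition-probe-< b (t₁ k) lt)) (here refl)))

    scan-phase : ∀ j k t → j + k ≡ n → t ≗ x₀ → ∃ λ t′ → t′ ≗ x₀ ×
      Star (Step machine α) (cfg (encode (scan (signature k α))) k t)
                            (cfg (encode (scan (signature n α))) n t′)
    scan-phase zero k t refl et = t , et , ε
    scan-phase (suc j) k t e et with scan-cell k t (subst (k <_) e (s≤s (m≤n+m k j))) et
    ... | t₁ , et₁ , r₁ with scan-phase j (suc k) t₁ (trans (+-suc j k) e) et₁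
    ...   | t′ , et′ , r = t′ , et′ , r₁ ◅◅ r

    emit-phase : ∀ w p t → p ≡ pred (length w) → length w ≤ n → ∃ λ c →
      Star (Step machine α) (cfg (encode (emit w)) p t) c × halt machine (state c) ≡ true ×
      tape c ≗ writeWord α w t
    emit-phase [] p t _ _ =
      cfg (encode (emit [])) p t , ε ,
      subst (λ q → halted q ≡ true) (sym (decode-encode (emit-∈ {[]} z≤n))) refl , λ i → refl
    emit-phase (c ∷ w) p t refl le
      with emit-phase w (move L (length w)) (writeIntv α (length w) c t) (move-L (length w)) (<⇒≤ le)
    ... | c′ , r , h , et = c′ , Step-transition⁻ (emit-∈ le) refl (here refl) ◅ r , h , et

    produce : ∀ w → w ∈ out (signature n α) →
      ∃ λ c → HaltingRun machine α y c × tape c ≗ writeWord α w x₀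
    produce w mw with scan-phase n 0 x₀ (+-identityʳ n) (λ i → refl)
    ... | t′ , et′ , r₁ with emit-phase w (move L n) (writeIntv α n (t′ n) t′)
                               (trans (move-L n) (cong pred (sym lw))) (≤-reflexive lw)
      where lw = out-length (signature n α) mw
    ...   | c , r₂ , h , et = c , (r₁ ◅◅ s ◅ r₂ , h) ,
            λ i → trans (et i) (writeWord-cong α w (λ j → trans (writeIntv-same α n t′ j) (et′ j)) i)
      where
      σ = signature n α
      full : ¬ length σ < n
      full lt = <-irrefl (length-signature n α) lt
      s : Step machine α (cfg (encode (scan σ)) n t′)
                         (cfg (encode (emit w)) (move L n) (writeIntv α n (t′ n) t′))
      s = Step-transition⁻ (scan-∈ (≤-reflexive (length-signature n α))) refl
            (subst (λ o → (emit w , t′ n , L) ∈ toList o) (sym (transition-scan-≥ (t′ n) full))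
                   (choose-∈ σ (t′ n) mw))

  machine-deterministic : (∀ σ → length (out σ) ≤ 1) → Deterministic machine
  machine-deterministic ≤1 i b = cong (map _) (single (lookup states i) b)
    where
    single : ∀ q b → List⁺.tail (transition q b) ≡ []
    single (scan σ) b with length σ <? n
    ... | yes _ = refl
    ... | no _ with out σ | ≤1 σ
    ...   | [] | _ = refl
    ...   | _ ∷ [] | _ = refl
    ...   | _ ∷ _ ∷ _ | s≤s ()
    single (probe σ _) b with length σ <? n
    ... | yes _ = refl
    ... | no _ = refl
    single (emit []) b = refl
    single (emit (_ ∷ _)) b = refl
    single loop b = refl

  machine-boundedTape : BoundedTape machine
  machine-boundedTape = suc n , λ α y _ c r → s≤s (Run.invariant-pos α y _ _ _ (Run.Reach-invariant α y r))

  -- Decreases along every step once looping is excluded: scanning spends two steps per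
  -- cell, emitting one step per letter.
  rank : State → ℕ
  rank (scan σ) = suc (suc ((n ∸ length σ) + (n ∸ length σ) + n))
  rank (probe σ b) = suc ((n ∸ length σ) + (n ∸ length σ) + n)
  rank (emit w) = length w
  rank loop = 0

  rank-step : ∀ q b {q′ c m} → halted q ≡ false → (q′ , c , m) ∈ toList (transition q b) →
    q ≢ loop → (∀ σ → q ≡ scan σ → ¬ length σ < n → out σ ≢ []) → rank q′ < rank q
  rank-step (scan σ) b hf mem _ ok with length σ <? n
  rank-step (scan σ) b hf (here refl) _ ok | yes _ = ≤-refl
  ... | no ≮ with choose-∈⁻ σ b mem
  ...   | inj₁ (eo , _) = ⊥-elim (ok σ refl ≮ eo)
  ...   | inj₂ (w , mw , refl , refl , refl) rewrite out-length σ mw =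
    s≤s (≤-trans (m≤n+m n (n ∸ length σ + (n ∸ length σ))) (n≤1+n _))
  rank-step (probe σ b) b′ hf mem _ ok with length σ <? n
  rank-step (probe σ b) b′ hf (here refl) _ ok | yes lt rewrite +-∸-assoc 1 lt =
    s≤s (s≤s (+-monoˡ-< n (subst (λ z → k + k < z) (sym (+-suc k k)) ≤-refl)))
    where k = n ∸ suc (length σ)
  rank-step (probe σ b) b′ hf (here refl) _ ok | no _ = s≤s z≤n
  rank-step (emit (c ∷ w)) b hf (here refl) _ ok = ≤-refl
  rank-step loop b hf mem ¬loop ok = ⊥-elim (¬loop refl)

  machine-alwaysHalts : (∀ α → out (signature n α) ≢ []) → AlwaysHalts machine
  machine-alwaysHalts nonempty α y _ = go _ (initCfg machine α y) init (n≤1+n _)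
    where
    open Run α y
    init : Invariantᶜ (initCfg machine α y)
    init = Reach-invariant ε
    not-loop : ∀ q p t → Invariant q p t → q ≢ loop
    not-loop loop p t (_ , eo) refl = nonempty α eo
    scan-ok : ∀ q p t → Invariant q p t → ∀ σ → q ≡ scan σ → ¬ length σ < n → out σ ≢ []
    scan-ok _ p t (eσ , _ , le , _) σ refl ≮ eo =
      nonempty α (subst (λ σ → out σ ≡ []) full eo)
      where full = trans eσ (cong (λ k → signature k α) (≤-antisym le (≮⇒≥ ≮)))
    rank-decreases : ∀ {c c′} → Step machine α c c′ → Invariantᶜ c →
      rank (lookup states (state c′)) < rank (lookup states (state c))
    rank-decreases {c} s inv with Step-transition s
    ... | q′ , b , m , mem , hf , refl with invariant-step _ (pos c) (tape c) inv hf mem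
    ...   | _ , q′∈ rewrite decode-encode q′∈ =
      rank-step _ _ hf mem (not-loop _ _ _ inv) (scan-ok _ _ _ inv)
    go : ∀ k c → Invariantᶜ c → rank (lookup states (state c)) < k → AllHalt machine α c
    go (suc k) c inv lt =
      acc λ s → go k _ (Invariantᶜ-step s inv) (≤-trans (rank-decreases s inv) (≤-pred lt))

Compatible : Maybe Bool → Bool → Set
Compatible nothing _ = ⊤
Compatible (just b) c = b ≡ c

compatible? : ∀ r c → Dec (Compatible r c)
compatible? nothing c = yes tt
compatible? (just b) c = b ≟ᵇ c

Fits : List (Maybe Bool) → List Bool → Set
Fits = Pointwise Compatible

Fits-forced : ∀ k α {w} → Fits (signature k α) w →
  ∀ {i b} → i < k → forced (lits α) i ≡ just b → toTape w i ≡ b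
Fits-forced (suc k) α {c ∷ w} (r ∷ rs) {i} {b} i<1+k ef with m≤n⇒m<n∨m≡n (≤-pred i<1+k)
... | inj₁ i<k = trans (toTape-other c w (λ e → <-irrefl (trans e |w|≡k) i<k)) (Fits-forced k α rs i<k ef)
  where |w|≡k = trans (sym (Pointwise-length rs)) (length-signature k α)
... | inj₂ refl rewrite ef = trans (cong (toTape (c ∷ w)) (sym |w|≡k)) (trans (toTape-here c w) (sym r))
  where |w|≡k = trans (sym (Pointwise-length rs)) (length-signature i α)

Fits-fromTape : ∀ k α s → (∀ {i b} → i < k → forced (lits α) i ≡ just b → s i ≡ b) →
  Fits (signature k α) (fromTape k s)
Fits-fromTape zero α s h = []
Fits-fromTape (suc k) α s h =
  here-compatible (forced (lits α) k) refl ∷ Fits-fromTape k α s (λ lt → h (≤-trans lt (n≤1+n k)))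
  where
  here-compatible : ∀ r → forced (lits α) k ≡ r → Compatible r (s k)
  here-compatible nothing _ = tt
  here-compatible (just b) ef = sym (h ≤-refl ef)

pick : ∀ {A : Set} → Bool → List A → List A
pick true [] = []
pick true (w ∷ _) = w ∷ []
pick false ws = ws

pick-⊆ : ∀ {A : Set} d (ws : List A) {w} → w ∈ pick d ws → w ∈ ws
pick-⊆ true (w ∷ ws) (here refl) = here refl
pick-⊆ false ws m = m

pick-length : ∀ {A : Set} (ws : List A) → length (pick true ws) ≤ 1
pick-length [] = z≤n
pick-length (w ∷ ws) = ≤-refl

pick-representative : ∀ {A : Set} d (ws : List A) {w} → w ∈ ws →
  ∃ λ w₁ → w₁ ∈ pick d ws × (d ≡ false → w₁ ≡ w)
pick-representative true (w₁ ∷ ws) m = w₁ , here refl , λ ()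
pick-representative false ws {w} m = w , m , λ _ → refl

pick-nonempty : ∀ {A : Set} d (ws : List A) → (∃ λ w → w ∈ ws) → pick d ws ≢ []
pick-nonempty true (_ ∷ _) _ ()
pick-nonempty false (_ ∷ _) _ ()

module Completeness (det hlt : Bool) (φ : Form) where
  open Canonical det hlt φ

  module CanonicalModel (v : Atom → Bool) (vΓ : Holds v (⋀ Γ)) where
    open Valuation v vΓ

    Respects : Intv → PForm → List Bool → Set
    Respects α β w = (v (box α β) ≡ true → Holds (toTape w) β) ×
                     (det ≡ true → v (box α β) ≡ true ⊎ ¬ Holds (toTape w) β)

    Admissible : List (Maybe Bool) → List Bool → Set
    Admissible σ w = Fits σ w × All (λ (α , β) → signature n α ≡ σ → Respects α β w) boxes

    admissible? : ∀ σ w → Dec (Admissible σ w)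
    admissible? σ w = pointwise? compatible? σ w ×-dec All.all? respects? boxes
      where
      respects? : ∀ ab → Dec (signature n (proj₁ ab) ≡ σ → Respects (proj₁ ab) (proj₂ ab) w)
      respects? (α , β) =
        List.≡-dec (Maybe.≡-dec _≟ᵇ_) (signature n α) σ →-dec
          ((v (box α β) ≟ᵇ true) →-dec (evalB (toTape w) β ≟ᵇ true)) ×-dec
          ((det ≟ᵇ true) →-dec ((v (box α β) ≟ᵇ true) ⊎-dec ¬? (evalB (toTape w) β ≟ᵇ true)))

    acceptable : List (Maybe Bool) → List (List Bool)
    acceptable σ = filter (admissible? σ) (words n)

    acceptable-admissible : ∀ σ {w} → w ∈ acceptable σ → Admissible σ w
    acceptable-admissible σ m = proj₂ (∈-filter⁻ (admissible? σ) {xs = words n} m)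

    -- Under F the machine must be deterministic, so it only ever outputs one word.
    out : List (Maybe Bool) → List (List Bool)
    out σ = pick det (acceptable σ)

    out-acceptable : ∀ σ {w} → w ∈ out σ → w ∈ acceptable σ
    out-acceptable σ = pick-⊆ det (acceptable σ)

    out-length : ∀ σ {w} → w ∈ out σ → length w ≡ n
    out-length σ m = listsOf-length bools n (proj₁ (∈-filter⁻ (admissible? σ) (out-acceptable σ m)))

    open Machine n out out-length

    xv : Tape
    xv = restrict n (λ i → v (X i))

    Mv : Model
    Mv = ⟨ machine , xv , restrict-finite n _ ⟩

    output-tape : ∀ α {w} → w ∈ out (signature n α) → ∀ t → t ≗ writeWord α w (setIntv α xv) →
      ∀ {i} → i < n → t i ≡ toTape w i
    output-tape α {w} mw t et {i} i<n with forced (lits α) i in ef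
    ... | just b = trans (et i) (trans (writeWord-forced α w _ ef) (trans (setIntv-forced α xv ef)
                     (sym (Fits-forced n α (proj₁ (acceptable-admissible _ (out-acceptable _ mw))) i<n ef))))
    ... | nothing = trans (et i) (writeWord-free α w _ (subst (i <_) (sym (out-length _ mw)) i<n) ef)

    output-evalB : ∀ {α β} → (α , β) ∈ boxes → ∀ {w} → w ∈ out (signature n α) → ∀ t →
      t ≗ writeWord α w (setIntv α xv) → evalB t β ≡ evalB (toTape w) β
    output-evalB {β = β} mβ {w} mw t et =
      evalB-cong t (toTape w) β λ i m → output-tape _ mw t et (box-vars mβ i m)

    output-respects : ∀ {α β} → (α , β) ∈ boxes → ∀ {w} → w ∈ out (signature n α) →
      Respects α β w
    output-respects mβ mw = All.lookup (proj₂ (acceptable-admissible _ (out-acceptable _ mw))) mβ refl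

    witness-acceptable : ∀ {α β₀} → (α , β₀) ∈ boxes → ∀ {rq} → (det ≡ true → rq ≡ failing α) →
      ∀ s → Witness α (holding α) rq s → fromTape n s ∈ acceptable (signature n α)
    witness-acceptable {α} mα {rq} all-failing s (sα , sP , sR) =
      ∈-filter⁺ (admissible? _) (fromTape-∈-words n s)
        (Fits-fromTape n α s (λ _ ef → Holds-conjLits⁻ s (lits α) sα (forced⇒∈ _ ef)) ,
         All.tabulate respects)
      where
      respects : ∀ {ab} → ab ∈ boxes → signature n (proj₁ ab) ≡ signature n α →
                 Respects (proj₁ ab) (proj₂ ab) (fromTape n s)
      respects {α′ , β} m e with signature-injective n α′ α (box-indices m) (box-indices mα) e
      ... | refl = (λ vt → trans ev (All.lookup sP (∈-filter⁺ _ (∈-boxed m) vt))) , refuted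
        where
        ev = evalB-fromTape n s β (box-vars m)
        refuted : det ≡ true → v (box α β) ≡ true ⊎ ¬ Holds (toTape (fromTape n s)) β
        refuted d with v (box α β) in vb
        ... | true = inj₁ refl
        ... | false = inj₂ λ h →
          All.lookup sR (subst (β ∈_) (sym (all-failing d)) (∈-filter⁺ _ (∈-boxed m) vb)) (trans (sym ev) h)

    failing-output : ∀ {α β} → (α , β) ∈ boxes → v (box α β) ≡ false →
      ∃ λ w → w ∈ out (signature n α) × ¬ Holds (toTape w) β
    failing-output {α} {β} mβ vf
      with demand-refuting det hlt (failing α) (∈-filter⁺ (λ β → v (box α β) ≟ᵇ false) (∈-boxed mβ) vf)
    ... | rq , r , single , all with witness (∈-map⁺ proj₁ mβ) r
    ...   | s , sw with pick-representative det (acceptable (signature n α)) (witness-acceptable mβ all s sw)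
    ...     | w , mw , same = w , mw , refutes det refl
      where
      refutes : ∀ d → det ≡ d → ¬ Holds (toTape w) β
      refutes true d h with proj₂ (output-respects mβ mw) d
      ... | inj₁ vt = false≢true (trans (sym vf) vt)
      ... | inj₂ ¬h = ¬h h
      refutes false d h =
        All.lookup (proj₂ (proj₂ sw)) (subst (β ∈_) (sym (single d)) (here refl))
          (trans (sym (evalB-fromTape n s β (box-vars mβ))) (subst (λ w → Holds (toTape w) β) (same d) h))

    Agree-box : ∀ {α β} → (α , β) ∈ boxes → Agree Mv v (box α β)
    Agree-box {α} {β} mβ = mk⇔ (λ sat → holds sat (v (box α β)) refl) holds→sat
      where
      holds→sat : v (box α β) ≡ true → Sat Mv ([ α ] β)
      holds→sat vt c hr =
        let w , mw , et = Run.HaltingRun-output α xv c hr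
        in trans (output-evalB mβ mw (tape c) et) (proj₁ (output-respects mβ mw) vt)
      holds : Sat Mv ([ α ] β) → ∀ b → v (box α β) ≡ b → b ≡ true
      holds sat true _ = refl
      holds sat false vf =
        let w , mw , ¬h = failing-output mβ vf
            c , hr , et = Run.produce α xv w mw
        in ⊥-elim (¬h (trans (sym (output-evalB mβ mw (tape c) et)) (sat c hr)))

    Agree-atoms : ∀ a → a ∈ atoms φ → Agree Mv v a
    Agree-atoms (X i) m =
      subst (λ b → (b ≡ true) ⇔ (v (X i) ≡ true)) (sym (restrict-< n _ (mentioned-< m (here refl))))
            (mk⇔ (λ e → e) (λ e → e))
    Agree-atoms (box α β) m = Agree-box (boxesOf-∈ (atoms φ) m)

    -- Under D every signature has an acceptable word: one from a witness if some
    -- intervention of φ has this signature, and otherwise any word fitting it.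
    out-nonempty : hlt ≡ true → ∀ α → out (signature n α) ≢ []
    out-nonempty refl α = pick-nonempty det (acceptable σ) (by-cases (any? sameSignature? boxes))
      where
      σ = signature n α
      sameSignature? : ∀ ab → Dec (signature n (proj₁ ab) ≡ σ)
      sameSignature? (α′ , _) = List.≡-dec (Maybe.≡-dec _≟ᵇ_) (signature n α′) σ
      by-cases : Dec (Any (λ ab → signature n (proj₁ ab) ≡ σ) boxes) → ∃ λ w → w ∈ acceptable σ
      by-cases (yes some) =
        let (α′ , _) , m , e = find some
            rq , r , all = demand-halting det (failing α′)
            s , sw = witness (∈-map⁺ proj₁ m) r
        in fromTape n s , subst (λ σ → fromTape n s ∈ acceptable σ) e (witness-acceptable m all s sw)
      by-cases (no none) = fromTape n s ,
        ∈-filter⁺ (admissible? σ) (fromTape-∈-words n s)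
          (Fits-fromTape n α s (λ _ ef → setIntv-forced α (λ _ → false) ef) ,
           All.tabulate λ m e → ⊥-elim (none (lose m e)))
        where s = setIntv α (λ _ → false)

    Mv-inClassFin : InClassFin det hlt Mv
    Mv-inClassFin =
      (λ { refl → machine-deterministic λ σ → pick-length (acceptable σ) }) ,
      (λ h → machine-alwaysHalts (out-nonempty h)) ,
      machine-boundedTape

  complete : Valid det hlt φ → AX[ det , hlt ]⊢ φ
  complete valid = pc-mp (pc-taut λ v → ⇒I v (⋀ Γ) φ λ vΓ →
      let open CanonicalModel v vΓ in to (Sat⇔Holds Mv v φ Agree-atoms) (valid Mv Mv-inClassFin))
    ⊢Γ

corollary1 : (det hlt : Bool) (φ : Form) →
    (AX[ det , hlt ]⊢ φ) ⇔ (∀ (M : Model) → InClassFin det hlt M → Sat M φ)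
corollary1 det hlt φ = mk⇔ sound (Completeness.complete det hlt φ)
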